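{- Let $n\ge 1$ and for $k\ge 0$ let $\widehat{C_k}(x)=C_k(n-x)$. Then for all integers $r,s$ with $0\le r,s\le n/2$, $$\frac{1}{n!}\sum_{k=0}^n w_{n-k}\,\widehat{C_r}(k)\,\widehat{C_s}(k)=r!\,\delta_{rs}.$$
   Context: For $k\ge 0$, the Charlier polynomial is $C_k(x)=(-1)^k+\sum_{i=1}^k(-1)^{k-i}\binom{k}{i}x(x-1)\cdots(x-i+1)$ (so $C_0=1$, $C_1(x)=x-1$, $C_2(x)=x^2-3x+1$). For $k\in\{0,\dots,n\}$, $w_k$ denotes the number of permutations of $n$ letters with exactly $k$ fixed points. $\delta_{rs}$ is the Kronecker delta. -}

module Defs where

open import Data.Nat as ℕ using (ℕ; zero; suc)
open import Data.Nat.Combinatorics using (_C_)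
open import Data.Integer as ℤ using (ℤ; +_; -_; _+_; _*_; _-_)
open import Data.Fin using (Fin; toℕ)
open import Data.Fin.Properties using (_≟_)
open import Data.Vec using (Vec; []; _∷_; lookup)
open import Data.List using (List; []; _∷_; _++_; map; concatMap; length; filter; upTo; allFin)
open import Relation.Nullary using (Dec; yes; no; ¬_)
open import Relation.Nullary.Decidable using (⌊_⌋)
open import Data.Bool using (Bool; true; false)
open import Relation.Binary.PropositionalEquality using (_≡_)

sumℤ : List ℤ → ℤ
sumℤ [] = + 0
sumℤ (x ∷ xs) = x + sumℤ xs

sumTo : ℕ → (ℕ → ℤ) → ℤ
sumTo m f = sumℤ (map f (upTo (suc m)))

sgn : ℕ → ℤ
sgn zero = + 1
sgn (suc k) = - sgn k

fall : ℤ → ℕ → ℤ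
fall x zero = + 1
fall x (suc i) = fall x i * (x - + i)

Charlier : ℕ → ℤ → ℤ
Charlier k x = sgn k + sumℤ (map (λ j → let i = suc j in
                   sgn (k ℕ.∸ i) * (+ (k C i)) * fall x i) (upTo k))

CharlierHat : ℕ → ℕ → ℤ → ℤ
CharlierHat n k x = Charlier k (+ n - x)

allVecs : (n m : ℕ) → List (Vec (Fin m) n)
allVecs zero m = [] ∷ []
allVecs (suc n) m = concatMap (λ v → map (λ a → a ∷ v) (allFin m)) (allVecs n m)

isInjective : ∀ {n} → Vec (Fin n) n → Bool
isInjective {n} v = allB (allFin n) where
  allB : List (Fin n) → Bool
  allB [] = true
  allB (i ∷ is) = andB (allJ (allFin n)) (allB is) where
    andB : Bool → Bool → Bool
    andB true b = b
    andB false _ = false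
    allJ : List (Fin n) → Bool
    allJ [] = true
    allJ (j ∷ js) with lookup v i ≟ lookup v j | i ≟ j
    ... | yes _ | no _ = false
    ... | _ | _ = allJ js

perms : (n : ℕ) → List (Vec (Fin n) n)
perms n = filter (λ v → isInjective v ≟B true) (allVecs n n) where
  _≟B_ : (a b : Bool) → Dec (a ≡ b)
  _≟B_ = Data.Bool._≟_

fixedPoints : ∀ {n} → Vec (Fin n) n → ℕ
fixedPoints {n} v = length (filter (λ i → lookup v i ≟ i) (allFin n))

w : ℕ → ℕ → ℕ
w n k = length (filter (λ σ → fixedPoints σ ℕ.≟ k) (perms n))

δ : ℕ → ℕ → ℕ
δ r s with r ℕ.≟ s
... | yes _ = 1
... | no _ = 0

-- Write L g = Σ_j w_j g(j), which is the sum of g(fix σ) over all permutations σ of n letters.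
-- The falling-factorial moments of the number of fixed points are L (x)_m = n! for m ≤ n
-- (there are (n)_m (n-m)! pairs of a permutation and an ordered m-tuple of distinct fixed
-- points); this is shown by induction over injections Fin k → Fin n, counting agreements with a
-- target that becomes partial once the first letter's value is deleted from the codomain.
-- The recurrence C_{s+2}(x) = (x-s-2) C_{s+1}(x) - (s+1) C_s(x) then gives
-- L ((x)_i C_s) = n! (i)_s whenever i + s ≤ n, and expanding C_r in falling factorials,
-- L (C_r C_s) = n! Σ_l c_{r,l} (l)_s, which vanishes for r < s and is n! r! for r = s.
-- The substitution k ↦ n - k turns the sum of the theorem into L (C_r C_s).

module Submission where

open import Algebra.Bundles using (CommutativeSemiring)
open import Data.Bool.Base using (true; false; if_then_else_)
open import Data.Empty using (⊥-elim)
open import Data.List.Base using (List; []; _∷_; _++_; map; concatMap; filter)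
open import Data.Nat as ℕ using (ℕ; zero; suc; _∸_; _<_; z≤n; s≤s)
open import Function.Base using (_∘_)
open import Relation.Nullary using (Dec; yes; no; does; ¬_)
open import Relation.Unary using (Decidable)

module FiniteSums {c ℓ} (R : CommutativeSemiring c ℓ) where

  open CommutativeSemiring R
  open import Relation.Binary.Reasoning.Setoid setoid
  open import Algebra.Properties.CommutativeSemigroup +-commutativeSemigroup using (interchange)

  ∑< : ℕ → (ℕ → Carrier) → Carrier
  ∑< zero    f = 0#
  ∑< (suc N) f = f 0 + ∑< N (f ∘ suc)

  ∑ₗ : ∀ {a} {X : Set a} → List X → (X → Carrier) → Carrier
  ∑ₗ []       f = 0#
  ∑ₗ (x ∷ xs) f = f x + ∑ₗ xs f

  𝟙 : ∀ {p} {P : Set p} → Dec P → Carrier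
  𝟙 d = if does d then 1# else 0#

  𝟙-yes : ∀ {p} {P : Set p} (d : Dec P) → P → 𝟙 d ≈ 1#
  𝟙-yes (yes _) _ = refl
  𝟙-yes (no ¬p) p = ⊥-elim (¬p p)

  𝟙-no : ∀ {p} {P : Set p} (d : Dec P) → ¬ P → 𝟙 d ≈ 0#
  𝟙-no (yes p) ¬p = ⊥-elim (¬p p)
  𝟙-no (no _)  _  = refl

  𝟙-cong : ∀ {p q} {P : Set p} {Q : Set q} → (P → Q) → (Q → P) → (d : Dec P) (e : Dec Q) → 𝟙 d ≈ 𝟙 e
  𝟙-cong P→Q Q→P (yes p) e = sym (𝟙-yes e (P→Q p))
  𝟙-cong P→Q Q→P (no ¬p) e = sym (𝟙-no e (¬p ∘ Q→P))

  ∑<-cong : ∀ N {f g : ℕ → Carrier} → (∀ i → i < N → f i ≈ g i) → ∑< N f ≈ ∑< N g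
  ∑<-cong zero    eq = refl
  ∑<-cong (suc N) eq = +-cong (eq 0 (s≤s z≤n)) (∑<-cong N (λ i i<N → eq (suc i) (s≤s i<N)))

  ∑<-zero : ∀ N {f : ℕ → Carrier} → (∀ i → i < N → f i ≈ 0#) → ∑< N f ≈ 0#
  ∑<-zero zero    eq = refl
  ∑<-zero (suc N) eq = begin
    _ + ∑< N _ ≈⟨ +-cong (eq 0 (s≤s z≤n)) (∑<-zero N (λ i i<N → eq (suc i) (s≤s i<N))) ⟩
    0# + 0#    ≈⟨ +-identityˡ 0# ⟩
    0#         ∎

  ∑<-distrib-+ : ∀ N (f g : ℕ → Carrier) → ∑< N (λ i → f i + g i) ≈ ∑< N f + ∑< N g
  ∑<-distrib-+ zero    f g = sym (+-identityˡ 0#)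
  ∑<-distrib-+ (suc N) f g = begin
    (f 0 + g 0) + ∑< N (λ i → f (suc i) + g (suc i))
      ≈⟨ +-congˡ (∑<-distrib-+ N (f ∘ suc) (g ∘ suc)) ⟩
    (f 0 + g 0) + (∑< N (f ∘ suc) + ∑< N (g ∘ suc))
      ≈⟨ interchange (f 0) (g 0) _ _ ⟩
    (f 0 + ∑< N (f ∘ suc)) + (g 0 + ∑< N (g ∘ suc)) ∎

  *-distribˡ-∑< : ∀ x N (f : ℕ → Carrier) → x * ∑< N f ≈ ∑< N (λ i → x * f i)
  *-distribˡ-∑< x zero    f = zeroʳ x
  *-distribˡ-∑< x (suc N) f = begin
    x * (f 0 + ∑< N (f ∘ suc))    ≈⟨ distribˡ x (f 0) _ ⟩
    x * f 0 + x * ∑< N (f ∘ suc)  ≈⟨ +-congˡ (*-distribˡ-∑< x N (f ∘ suc)) ⟩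
    x * f 0 + ∑< N (λ i → x * f (suc i)) ∎

  ∑<-init-last : ∀ N (f : ℕ → Carrier) → ∑< (suc N) f ≈ ∑< N f + f N
  ∑<-init-last zero    f = trans (+-identityʳ (f 0)) (sym (+-identityˡ (f 0)))
  ∑<-init-last (suc N) f = trans (+-congˡ (∑<-init-last N (f ∘ suc))) (sym (+-assoc (f 0) _ _))

  ∑<-reverse : ∀ n (f : ℕ → Carrier) → ∑< (suc n) (λ k → f (n ∸ k)) ≈ ∑< (suc n) f
  ∑<-reverse zero    f = refl
  ∑<-reverse (suc n) f = begin
    f (suc n) + ∑< (suc n) (λ k → f (n ∸ k)) ≈⟨ +-congˡ (∑<-reverse n f) ⟩
    f (suc n) + ∑< (suc n) f                 ≈⟨ +-comm (f (suc n)) _ ⟩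
    ∑< (suc n) f + f (suc n)                 ≈⟨ sym (∑<-init-last (suc n) f) ⟩
    ∑< (suc (suc n)) f                       ∎

  ∑<-δ : ∀ N {c} (g : ℕ → Carrier) → c < N → ∑< N (λ j → 𝟙 (c ℕ.≟ j) * g j) ≈ g c
  ∑<-δ (suc N) {zero} g _ = begin
    1# * g 0 + ∑< N (λ j → 0# * g (suc j)) ≈⟨ +-cong (*-identityˡ (g 0)) (∑<-zero N (λ j _ → zeroˡ (g (suc j)))) ⟩
    g 0 + 0#                               ≈⟨ +-identityʳ (g 0) ⟩
    g 0                                    ∎
  ∑<-δ (suc N) {suc c} g (s≤s c<N) = begin
    0# * g 0 + ∑< N (λ j → 𝟙 (c ℕ.≟ j) * g (suc j)) ≈⟨ +-cong (zeroˡ (g 0)) (∑<-δ N (g ∘ suc) c<N) ⟩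
    0# + g (suc c)                                   ≈⟨ +-identityˡ (g (suc c)) ⟩
    g (suc c)                                        ∎

  module _ {a} {X : Set a} where

    ∑ₗ-cong : ∀ (xs : List X) {f g : X → Carrier} → (∀ x → f x ≈ g x) → ∑ₗ xs f ≈ ∑ₗ xs g
    ∑ₗ-cong []       eq = refl
    ∑ₗ-cong (x ∷ xs) eq = +-cong (eq x) (∑ₗ-cong xs eq)

    ∑ₗ-zero : ∀ (xs : List X) → ∑ₗ xs (λ _ → 0#) ≈ 0#
    ∑ₗ-zero []       = refl
    ∑ₗ-zero (x ∷ xs) = trans (+-congˡ (∑ₗ-zero xs)) (+-identityˡ 0#)

    ∑ₗ-++ : ∀ (xs ys : List X) f → ∑ₗ (xs ++ ys) f ≈ ∑ₗ xs f + ∑ₗ ys f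
    ∑ₗ-++ []       ys f = sym (+-identityˡ _)
    ∑ₗ-++ (x ∷ xs) ys f = trans (+-congˡ (∑ₗ-++ xs ys f)) (sym (+-assoc (f x) _ _))

    ∑ₗ-distrib-+ : ∀ (xs : List X) f g → ∑ₗ xs (λ x → f x + g x) ≈ ∑ₗ xs f + ∑ₗ xs g
    ∑ₗ-distrib-+ []       f g = sym (+-identityˡ 0#)
    ∑ₗ-distrib-+ (x ∷ xs) f g = trans (+-congˡ (∑ₗ-distrib-+ xs f g)) (interchange (f x) (g x) _ _)

    *-distribˡ-∑ₗ : ∀ y (xs : List X) f → y * ∑ₗ xs f ≈ ∑ₗ xs (λ x → y * f x)
    *-distribˡ-∑ₗ y []       f = zeroʳ y
    *-distribˡ-∑ₗ y (x ∷ xs) f = trans (distribˡ y (f x) _) (+-congˡ (*-distribˡ-∑ₗ y xs f))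

    ∑ₗ-filter : ∀ {p} {P : X → Set p} (P? : Decidable P) (xs : List X) f →
                ∑ₗ (filter P? xs) f ≈ ∑ₗ xs (λ x → 𝟙 (P? x) * f x)
    ∑ₗ-filter P? []       f = refl
    ∑ₗ-filter P? (x ∷ xs) f with does (P? x)
    ... | true  = +-cong (sym (*-identityˡ (f x))) (∑ₗ-filter P? xs f)
    ... | false = trans (∑ₗ-filter P? xs f) (sym (trans (+-congʳ (zeroˡ (f x))) (+-identityˡ _)))

  ∑<-∑ₗ-comm : ∀ {a} {X : Set a} N (xs : List X) (f : X → ℕ → Carrier) →
              ∑< N (λ j → ∑ₗ xs (λ x → f x j)) ≈ ∑ₗ xs (λ x → ∑< N (f x))
  ∑<-∑ₗ-comm N []       f = ∑<-zero N (λ _ _ → refl)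
  ∑<-∑ₗ-comm N (x ∷ xs) f = trans (∑<-distrib-+ N (f x) _) (+-congˡ (∑<-∑ₗ-comm N xs f))

  ∑ₗ-map : ∀ {a b} {X : Set a} {Y : Set b} (g : X → Y) (xs : List X) f → ∑ₗ (map g xs) f ≈ ∑ₗ xs (f ∘ g)
  ∑ₗ-map g []       f = refl
  ∑ₗ-map g (x ∷ xs) f = +-congˡ (∑ₗ-map g xs f)

  ∑ₗ-concatMap : ∀ {a b} {X : Set a} {Y : Set b} (h : X → List Y) (xs : List X) f →
                 ∑ₗ (concatMap h xs) f ≈ ∑ₗ xs (λ x → ∑ₗ (h x) f)
  ∑ₗ-concatMap h []       f = refl
  ∑ₗ-concatMap h (x ∷ xs) f = trans (∑ₗ-++ (h x) (concatMap h xs) f) (+-congˡ (∑ₗ-concatMap h xs f))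

  ∑ₗ-comm : ∀ {a b} {X : Set a} {Y : Set b} (xs : List X) (ys : List Y) (f : X → Y → Carrier) →
            ∑ₗ xs (λ x → ∑ₗ ys (f x)) ≈ ∑ₗ ys (λ y → ∑ₗ xs (λ x → f x y))
  ∑ₗ-comm []       ys f = sym (∑ₗ-zero ys)
  ∑ₗ-comm (x ∷ xs) ys f = trans (+-congˡ (∑ₗ-comm xs ys f)) (sym (∑ₗ-distrib-+ ys (f x) _))

open import Data.Bool as Bool using (Bool)
open import Data.Fin as Fin using (Fin; zero; suc; punchIn; punchOut)
import Data.Fin.Properties as Finₚ
open import Data.List using (length; allFin; tabulate; applyUpTo)
import Data.List.Properties as Listₚ
open import Data.List.Relation.Unary.All using (All; []; _∷_)
import Data.List.Relation.Unary.All.Properties as Allₚ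
open import Data.Maybe using (Maybe; just; nothing)
open import Data.Nat using (_≤_; _!)
open import Data.Nat.Combinatorics using (_C_; nC1≡n; nCn≡1; nCk+nC[k+1]≡[n+1]C[k+1]; k>n⇒nCk≡0)
import Data.Nat.Properties as ℕₚ
open import Data.Product as Prod using (_×_; _,_)
open import Data.Unit using (⊤; tt)
open import Data.Vec as Vec using (Vec; []; _∷_; lookup)
open import Function.Base using (id)
open import Function.Definitions using (Injective)
open import Relation.Binary.Definitions using (tri<; tri≈; tri>)
open import Relation.Binary.PropositionalEquality
open import Relation.Nullary.Decidable using (¬?)

open import Defs

module ℕ∑ = FiniteSums ℕₚ.+-*-commutativeSemiring

module FixedPointMoments where

  open import Data.Nat using (_+_; _*_)
  open import Data.Nat.Tactic.RingSolver using (solve-∀)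

  open ℕ∑
  open ≡-Reasoning

  falling : ℕ → ℕ → ℕ
  falling x zero    = 1
  falling x (suc m) = x * falling (x ∸ 1) m

  falling-<⇒≡0 : ∀ x m → x < m → falling x m ≡ 0
  falling-<⇒≡0 zero    (suc m) _         = refl
  falling-<⇒≡0 (suc x) (suc m) (s≤s x<m) = trans (cong (suc x *_) (falling-<⇒≡0 x m x<m)) (ℕₚ.*-zeroʳ (suc x))

  falling-sucʳ : ∀ x m → falling x (suc m) ≡ falling x m * (x ∸ m)
  falling-sucʳ x zero    = trans (ℕₚ.*-identityʳ x) (sym (ℕₚ.+-identityʳ x))
  falling-sucʳ x (suc m) = begin
    x * falling (x ∸ 1) (suc m)           ≡⟨ cong (x *_) (falling-sucʳ (x ∸ 1) m) ⟩
    x * (falling (x ∸ 1) m * (x ∸ 1 ∸ m)) ≡⟨ cong (λ y → x * (falling (x ∸ 1) m * y)) (ℕₚ.∸-+-assoc x 1 m) ⟩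
    x * (falling (x ∸ 1) m * (x ∸ suc m)) ≡⟨ ℕₚ.*-assoc x _ _ ⟨
    x * falling (x ∸ 1) m * (x ∸ suc m)   ∎

  falling-sucˡ : ∀ x m → falling (suc x) m ≡ falling x m + m * falling x (m ∸ 1)
  falling-sucˡ x zero    = refl
  falling-sucˡ x (suc m) with m ℕₚ.≤? x
  ... | yes m≤x = begin
    suc x * falling x m                         ≡⟨ cong (λ y → suc y * falling x m) (ℕₚ.m∸n+n≡m m≤x) ⟨
    suc (x ∸ m + m) * falling x m               ≡⟨ rearrange (x ∸ m) m (falling x m) ⟩
    falling x m * (x ∸ m) + suc m * falling x m ≡⟨ cong (_+ suc m * falling x m) (falling-sucʳ x m) ⟨
    falling x (suc m) + suc m * falling x m     ∎
    where rearrange : ∀ a m F → suc (a + m) * F ≡ F * a + suc m * F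
          rearrange = solve-∀
  ... | no m≰x rewrite falling-<⇒≡0 x m (ℕₚ.≰⇒> m≰x) | falling-<⇒≡0 x (suc m) (ℕₚ.m<n⇒m<1+n (ℕₚ.≰⇒> m≰x)) =
    trans (ℕₚ.*-zeroʳ x) (sym (ℕₚ.*-zeroʳ m))

  falling-diag : ∀ n → falling n n ≡ n !
  falling-diag zero    = refl
  falling-diag (suc n) = cong (suc n *_) (falling-diag n)

  falling-split : ∀ n m → m ≤ n → falling n m * falling (n ∸ m) (n ∸ m) ≡ n !
  falling-split n       zero    _         = trans (ℕₚ.+-identityʳ _) (falling-diag n)
  falling-split (suc n) (suc m) (s≤s m≤n) =
    trans (ℕₚ.*-assoc (suc n) (falling n m) _) (cong (suc n *_) (falling-split n m m≤n))

  falling-suc-∸ : ∀ {k} n m → m ≤ k → falling (suc n ∸ m) (suc k ∸ m) ≡ (suc n ∸ m) * falling (n ∸ m) (k ∸ m)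
  falling-suc-∸ {k} n m m≤k = begin
    falling (suc n ∸ m) (suc k ∸ m)               ≡⟨ cong (falling (suc n ∸ m)) (ℕₚ.+-∸-assoc 1 m≤k) ⟩
    (suc n ∸ m) * falling (suc n ∸ m ∸ 1) (k ∸ m) ≡⟨ cong (λ x → (suc n ∸ m) * falling x (k ∸ m)) pred-eq ⟩
    (suc n ∸ m) * falling (n ∸ m) (k ∸ m)         ∎
    where
    pred-eq : suc n ∸ m ∸ 1 ≡ n ∸ m
    pred-eq = trans (ℕₚ.∸-+-assoc (suc n) m 1) (cong (suc n ∸_) (ℕₚ.+-comm m 1))

  length≡∑ₗ1 : ∀ {a} {X : Set a} (xs : List X) → length xs ≡ ∑ₗ xs (λ _ → 1)
  length≡∑ₗ1 []       = refl
  length≡∑ₗ1 (x ∷ xs) = cong suc (length≡∑ₗ1 xs)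

  ∑-allFin-suc : ∀ n (f : Fin (suc n) → ℕ) → ∑ₗ (allFin (suc n)) f ≡ f zero + ∑ₗ (allFin n) (f ∘ suc)
  ∑-allFin-suc n f = cong (f zero +_) (begin
    ∑ₗ (tabulate suc) f              ≡⟨ cong (λ xs → ∑ₗ xs f) (Listₚ.map-tabulate id suc) ⟨
    ∑ₗ (map suc (allFin n)) f        ≡⟨ ∑ₗ-map suc (allFin n) f ⟩
    ∑ₗ (allFin n) (f ∘ suc)          ∎)

  ∑-allFin-const : ∀ n c → ∑ₗ (allFin n) (λ _ → c) ≡ n * c
  ∑-allFin-const zero    c = refl
  ∑-allFin-const (suc n) c = trans (∑-allFin-suc n (λ _ → c)) (cong (c +_) (∑-allFin-const n c))

  ∑ₗ-mono-≤ : ∀ {a} {X : Set a} (xs : List X) {f g : X → ℕ} → (∀ x → f x ≤ g x) → ∑ₗ xs f ≤ ∑ₗ xs g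
  ∑ₗ-mono-≤ []       f≤g = z≤n
  ∑ₗ-mono-≤ (x ∷ xs) f≤g = ℕₚ.+-mono-≤ (f≤g x) (∑ₗ-mono-≤ xs f≤g)

  ∑-allFin-δ : ∀ n (b : Fin n) (g : Fin n → ℕ) → ∑ₗ (allFin n) (λ a → 𝟙 (b Fin.≟ a) * g a) ≡ g b
  ∑-allFin-δ (suc n) zero g = begin
    ∑ₗ (allFin (suc n)) (λ a → 𝟙 (zero Fin.≟ a) * g a) ≡⟨ ∑-allFin-suc n (λ a → 𝟙 (zero Fin.≟ a) * g a) ⟩
    g zero + 0 + ∑ₗ (allFin n) (λ _ → 0)               ≡⟨ cong (g zero + 0 +_) (∑ₗ-zero (allFin n)) ⟩
    g zero + 0 + 0                                     ≡⟨ trans (ℕₚ.+-identityʳ _) (ℕₚ.+-identityʳ _) ⟩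
    g zero                                             ∎
  ∑-allFin-δ (suc n) (suc b) g = trans (∑-allFin-suc n (λ a → 𝟙 (suc b Fin.≟ a) * g a)) (∑-allFin-δ n b (g ∘ suc))

  ∑-allFin-punchIn : ∀ n (a : Fin (suc n)) (h : Fin (suc n) → ℕ) →
    ∑ₗ (allFin (suc n)) (λ b → 𝟙 (¬? (a Fin.≟ b)) * h b) ≡ ∑ₗ (allFin n) (h ∘ punchIn a)
  ∑-allFin-punchIn n zero h = begin
    ∑ₗ (allFin (suc n)) (λ b → 𝟙 (¬? (zero Fin.≟ b)) * h b)
      ≡⟨ ∑-allFin-suc n (λ b → 𝟙 (¬? (zero Fin.≟ b)) * h b) ⟩
    0 + ∑ₗ (allFin n) (λ b → h (suc b) + 0)
      ≡⟨ ∑ₗ-cong (allFin n) (λ b → ℕₚ.+-identityʳ (h (suc b))) ⟩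
    ∑ₗ (allFin n) (h ∘ suc) ∎
  ∑-allFin-punchIn zero    (suc ()) h
  ∑-allFin-punchIn (suc n) (suc a)  h = begin
    ∑ₗ (allFin (suc (suc n))) (λ b → 𝟙 (¬? (suc a Fin.≟ b)) * h b)
      ≡⟨ ∑-allFin-suc (suc n) (λ b → 𝟙 (¬? (suc a Fin.≟ b)) * h b) ⟩
    h zero + 0 + ∑ₗ (allFin (suc n)) (λ b → 𝟙 (¬? (a Fin.≟ b)) * h (suc b))
      ≡⟨ cong₂ _+_ (ℕₚ.+-identityʳ (h zero)) (∑-allFin-punchIn n a (h ∘ suc)) ⟩
    h zero + ∑ₗ (allFin n) (h ∘ suc ∘ punchIn a)
      ≡⟨ ∑-allFin-suc n (h ∘ punchIn (suc a)) ⟨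
    ∑ₗ (allFin (suc n)) (h ∘ punchIn (suc a)) ∎

  ∑-allVecs-suc : ∀ k n (f : Vec (Fin n) (suc k) → ℕ) →
    ∑ₗ (allVecs (suc k) n) f ≡ ∑ₗ (allVecs k n) (λ v → ∑ₗ (allFin n) (λ b → f (b ∷ v)))
  ∑-allVecs-suc k n f = trans (∑ₗ-concatMap _ (allVecs k n) f)
    (∑ₗ-cong (allVecs k n) (λ v → ∑ₗ-map (_∷ v) (allFin n) f))

  𝟙∉ : ∀ {n k} → Fin n → Vec (Fin n) k → ℕ
  𝟙∉ a []      = 1
  𝟙∉ a (b ∷ v) = 𝟙 (¬? (a Fin.≟ b)) * 𝟙∉ a v

  𝟙inj : ∀ {n k} → Vec (Fin n) k → ℕ
  𝟙inj []      = 1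
  𝟙inj (a ∷ v) = 𝟙∉ a v * 𝟙inj v

  ∑-avoiding : ∀ k n (a : Fin (suc n)) (g : Vec (Fin (suc n)) k → ℕ) →
    ∑ₗ (allVecs k (suc n)) (λ v → 𝟙∉ a v * g v) ≡ ∑ₗ (allVecs k n) (λ w → g (Vec.map (punchIn a) w))
  ∑-avoiding zero    n a g = cong (_+ 0) (ℕₚ.*-identityˡ (g []))
  ∑-avoiding (suc k) n a g = begin
    ∑ₗ (allVecs (suc k) (suc n)) (λ v → 𝟙∉ a v * g v)
      ≡⟨ ∑-allVecs-suc k (suc n) _ ⟩
    ∑ₗ (allVecs k (suc n)) (λ v → ∑ₗ (allFin (suc n)) (λ b → 𝟙 (¬? (a Fin.≟ b)) * 𝟙∉ a v * g (b ∷ v)))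
      ≡⟨ ∑ₗ-cong (allVecs k (suc n)) (λ v → pullOut v) ⟩
    ∑ₗ (allVecs k (suc n)) (λ v → 𝟙∉ a v * ∑ₗ (allFin (suc n)) (λ b → 𝟙 (¬? (a Fin.≟ b)) * g (b ∷ v)))
      ≡⟨ ∑-avoiding k n a _ ⟩
    ∑ₗ (allVecs k n) (λ w → ∑ₗ (allFin (suc n)) (λ b → 𝟙 (¬? (a Fin.≟ b)) * g (b ∷ Vec.map (punchIn a) w)))
      ≡⟨ ∑ₗ-cong (allVecs k n) (λ w → ∑-allFin-punchIn n a (λ b → g (b ∷ Vec.map (punchIn a) w))) ⟩
    ∑ₗ (allVecs k n) (λ w → ∑ₗ (allFin n) (λ b → g (punchIn a b ∷ Vec.map (punchIn a) w)))
      ≡⟨ ∑-allVecs-suc k n (λ w → g (Vec.map (punchIn a) w)) ⟨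
    ∑ₗ (allVecs (suc k) n) (λ w → g (Vec.map (punchIn a) w)) ∎
    where
    pullOut : ∀ v → ∑ₗ (allFin (suc n)) (λ b → 𝟙 (¬? (a Fin.≟ b)) * 𝟙∉ a v * g (b ∷ v))
                  ≡ 𝟙∉ a v * ∑ₗ (allFin (suc n)) (λ b → 𝟙 (¬? (a Fin.≟ b)) * g (b ∷ v))
    pullOut v = trans (∑ₗ-cong (allFin (suc n)) (λ b → rearrange (𝟙 (¬? (a Fin.≟ b))) (𝟙∉ a v) (g (b ∷ v))))
                      (sym (*-distribˡ-∑ₗ (𝟙∉ a v) (allFin (suc n)) _))
      where rearrange : ∀ x y z → x * y * z ≡ y * (x * z)
            rearrange = solve-∀

  𝟙∉-punchIn : ∀ {n k} (a : Fin (suc n)) b (w : Vec (Fin n) k) →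
               𝟙∉ (punchIn a b) (Vec.map (punchIn a) w) ≡ 𝟙∉ b w
  𝟙∉-punchIn a b []      = refl
  𝟙∉-punchIn a b (c ∷ w) = cong₂ _*_
    (𝟙-cong (_∘ cong (punchIn a)) (_∘ Finₚ.punchIn-injective a b c)
            (¬? (punchIn a b Fin.≟ punchIn a c)) (¬? (b Fin.≟ c)))
    (𝟙∉-punchIn a b w)

  𝟙inj-punchIn : ∀ {n k} (a : Fin (suc n)) (w : Vec (Fin n) k) → 𝟙inj (Vec.map (punchIn a) w) ≡ 𝟙inj w
  𝟙inj-punchIn a []      = refl
  𝟙inj-punchIn a (b ∷ w) = cong₂ _*_ (𝟙∉-punchIn a b w) (𝟙inj-punchIn a w)

  𝟙≤1 : ∀ {p} {P : Set p} (d : Dec P) → 𝟙 d ≤ 1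
  𝟙≤1 (yes _) = ℕₚ.≤-refl
  𝟙≤1 (no _)  = z≤n

  𝟙[x≟1]≡x : ∀ x → x ≤ 1 → 𝟙 (x ℕ.≟ 1) ≡ x
  𝟙[x≟1]≡x zero       _ = refl
  𝟙[x≟1]≡x (suc zero) _ = refl
  𝟙[x≟1]≡x (suc (suc _)) (s≤s ())

  𝟙∉≤1 : ∀ {n k} (a : Fin n) (v : Vec (Fin n) k) → 𝟙∉ a v ≤ 1
  𝟙∉≤1 a []      = ℕₚ.≤-refl
  𝟙∉≤1 a (b ∷ v) = ℕₚ.*-mono-≤ (𝟙≤1 (¬? (a Fin.≟ b))) (𝟙∉≤1 a v)

  𝟙inj≤1 : ∀ {n k} (v : Vec (Fin n) k) → 𝟙inj v ≤ 1
  𝟙inj≤1 []      = ℕₚ.≤-refl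
  𝟙inj≤1 (a ∷ v) = ℕₚ.*-mono-≤ (𝟙∉≤1 a v) (𝟙inj≤1 v)

  𝟙∉≡1⇒∉ : ∀ {n k} (a : Fin n) (v : Vec (Fin n) k) → 𝟙∉ a v ≡ 1 → ∀ i → lookup v i ≢ a
  𝟙∉≡1⇒∉ a (b ∷ v) eq zero with a Fin.≟ b
  ... | no a≢b = a≢b ∘ sym
  𝟙∉≡1⇒∉ a (b ∷ v) () zero | yes _
  𝟙∉≡1⇒∉ a (b ∷ v) eq (suc i) = 𝟙∉≡1⇒∉ a v (ℕₚ.m*n≡1⇒n≡1 (𝟙 (¬? (a Fin.≟ b))) _ eq) i

  ∉⇒𝟙∉≡1 : ∀ {n k} (a : Fin n) (v : Vec (Fin n) k) → (∀ i → lookup v i ≢ a) → 𝟙∉ a v ≡ 1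
  ∉⇒𝟙∉≡1 a []      _ = refl
  ∉⇒𝟙∉≡1 a (b ∷ v) ∉ =
    cong₂ _*_ (𝟙-yes (¬? (a Fin.≟ b)) (λ a≡b → ∉ zero (sym a≡b))) (∉⇒𝟙∉≡1 a v (∉ ∘ suc))

  𝟙inj≡1⇒injective : ∀ {n k} (v : Vec (Fin n) k) → 𝟙inj v ≡ 1 → Injective _≡_ _≡_ (lookup v)
  𝟙inj≡1⇒injective (a ∷ v) eq {zero}  {zero}  _ = refl
  𝟙inj≡1⇒injective (a ∷ v) eq {zero}  {suc j} e = ⊥-elim (𝟙∉≡1⇒∉ a v (ℕₚ.m*n≡1⇒m≡1 _ _ eq) j (sym e))
  𝟙inj≡1⇒injective (a ∷ v) eq {suc i} {zero}  e = ⊥-elim (𝟙∉≡1⇒∉ a v (ℕₚ.m*n≡1⇒m≡1 _ _ eq) i e)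
  𝟙inj≡1⇒injective (a ∷ v) eq {suc i} {suc j} e = cong suc (𝟙inj≡1⇒injective v (ℕₚ.m*n≡1⇒n≡1 (𝟙∉ a v) _ eq) e)

  injective⇒𝟙inj≡1 : ∀ {n k} (v : Vec (Fin n) k) → Injective _≡_ _≡_ (lookup v) → 𝟙inj v ≡ 1
  injective⇒𝟙inj≡1 []      _   = refl
  injective⇒𝟙inj≡1 (a ∷ v) inj = cong₂ _*_ (∉⇒𝟙∉≡1 a v (λ i e → Finₚ.0≢1+n (inj (sym e))))
                                           (injective⇒𝟙inj≡1 v (Finₚ.suc-injective ∘ inj))

  module _ {n} (v : Vec (Fin n) n) where

    -- isInjective is defined through anonymous local functions; rows and row are metavariables
    -- that the two unfolding lemmas below solve to exactly those functions.
    mutual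
      rows : List (Fin n) → Bool
      rows = _

      row : Fin n → List (Fin n) → List (Fin n) → Bool → Bool
      row = _

      private
        rows-unfold : ∀ b → isInjective v ≡ b → rows (allFin n) ≡ b
        rows-unfold b e with allFin n
        ... | _ = e

        row-unfold : ∀ i is b → rows (i ∷ is) ≡ b → row i is (allFin n) (rows is) ≡ b
        row-unfold i is b e with allFin n | rows is
        ... | _ | _ = e

    Separates : Fin n → Fin n → Set
    Separates i j = lookup v i ≡ lookup v j → i ≡ j

    row-sound : ∀ i is js c → row i is js c ≡ true → All (Separates i) js × c ≡ true
    row-sound i is []       c h = [] , h
    row-sound i is (j ∷ js) c h with lookup v i Fin.≟ lookup v j | i Fin.≟ j
    row-sound i is (j ∷ js) c () | yes _ | no _
    ... | yes _ | yes i≡j = Prod.map₁ ((λ _ → i≡j) ∷_) (row-sound i is js c h)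
    ... | no vi≢vj | _    = Prod.map₁ ((⊥-elim ∘ vi≢vj) ∷_) (row-sound i is js c h)

    row-complete : ∀ i is js c → All (Separates i) js → c ≡ true → row i is js c ≡ true
    row-complete i is []       c _          h = h
    row-complete i is (j ∷ js) c (sep ∷ seps) h with lookup v i Fin.≟ lookup v j | i Fin.≟ j
    ... | yes vi≡vj | no i≢j = ⊥-elim (i≢j (sep vi≡vj))
    ... | yes _     | yes _  = row-complete i is js c seps h
    ... | no _      | _      = row-complete i is js c seps h

    rows-sound : ∀ is → rows is ≡ true → All (λ i → All (Separates i) (allFin n)) is
    rows-sound []       _ = []
    rows-sound (i ∷ is) h with row-sound i is (allFin n) (rows is) h
    ... | seps , h′ = seps ∷ rows-sound is h′

    rows-complete : ∀ is → All (λ i → All (Separates i) (allFin n)) is → rows is ≡ true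
    rows-complete []       _            = refl
    rows-complete (i ∷ is) (seps ∷ sepss) = row-complete i is (allFin n) (rows is) seps (rows-complete is sepss)

    isInjective⇒injective : isInjective v ≡ true → Injective _≡_ _≡_ (lookup v)
    isInjective⇒injective h {i} {j} = Allₚ.tabulate⁻ (Allₚ.tabulate⁻ (rows-sound (allFin n) h) i) j

    injective⇒isInjective : Injective _≡_ _≡_ (lookup v) → isInjective v ≡ true
    injective⇒isInjective inj = rows-complete (allFin n) (Allₚ.tabulate⁺ (λ i → Allₚ.tabulate⁺ (λ j → inj)))

    𝟙-isInjective : 𝟙 (isInjective v Bool.≟ true) ≡ 𝟙inj v
    𝟙-isInjective = trans
      (𝟙-cong (injective⇒𝟙inj≡1 v ∘ isInjective⇒injective) (injective⇒isInjective ∘ 𝟙inj≡1⇒injective v)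
              (isInjective v Bool.≟ true) (𝟙inj v ℕ.≟ 1))
      (𝟙[x≟1]≡x (𝟙inj v) (𝟙inj≤1 v))

  PartialMap : ℕ → ℕ → Set
  PartialMap n k = Vec (Maybe (Fin n)) k

  hit : ∀ {n} → Maybe (Fin n) → Fin n → ℕ
  hit nothing  a = 0
  hit (just b) a = 𝟙 (b Fin.≟ a)

  agreements : ∀ {n k} → PartialMap n k → Vec (Fin n) k → ℕ
  agreements []       []      = 0
  agreements (t ∷ ts) (a ∷ v) = hit t a + agreements ts v

  occurrences : ∀ {n k} → Fin n → PartialMap n k → ℕ
  occurrences a []       = 0
  occurrences a (t ∷ ts) = hit t a + occurrences a ts

  defined : ∀ {n k} → PartialMap n k → ℕ
  defined []             = 0
  defined (nothing ∷ ts) = defined ts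
  defined (just _ ∷ ts)  = suc (defined ts)

  Distinct : ∀ {n k} → PartialMap n k → Set
  Distinct []             = ⊤
  Distinct (nothing ∷ ts) = Distinct ts
  Distinct (just b ∷ ts)  = occurrences b ts ≡ 0 × Distinct ts

  forget : ∀ {n} → Fin (suc n) → Maybe (Fin (suc n)) → Maybe (Fin n)
  forget a nothing = nothing
  forget a (just b) with a Fin.≟ b
  ... | yes _   = nothing
  ... | no  a≢b = just (punchOut a≢b)

  removeValue : ∀ {n k} → Fin (suc n) → PartialMap (suc n) k → PartialMap n k
  removeValue a = Vec.map (forget a)

  hit-forget : ∀ {n} (a : Fin (suc n)) t x → hit (forget a t) x ≡ hit t (punchIn a x)
  hit-forget a nothing  x = refl
  hit-forget a (just b) x with a Fin.≟ b
  ... | yes refl = sym (𝟙-no (a Fin.≟ punchIn a x) (Finₚ.punchInᵢ≢i a x ∘ sym))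
  ... | no  a≢b  = 𝟙-cong
    (λ e → trans (sym (Finₚ.punchIn-punchOut a≢b)) (cong (punchIn a) e))
    (λ e → Finₚ.punchIn-injective a _ _ (trans (Finₚ.punchIn-punchOut a≢b) e))
    (punchOut a≢b Fin.≟ x) (b Fin.≟ punchIn a x)

  agreements-punchIn : ∀ {n k} (a : Fin (suc n)) (t : PartialMap (suc n) k) w →
                       agreements t (Vec.map (punchIn a) w) ≡ agreements (removeValue a t) w
  agreements-punchIn a []      []      = refl
  agreements-punchIn a (t ∷ ts) (x ∷ w) = cong₂ _+_ (sym (hit-forget a t x)) (agreements-punchIn a ts w)

  occurrences-removeValue : ∀ {n k} (a : Fin (suc n)) (t : PartialMap (suc n) k) x →
                            occurrences x (removeValue a t) ≡ occurrences (punchIn a x) t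
  occurrences-removeValue a []       x = refl
  occurrences-removeValue a (t ∷ ts) x = cong₂ _+_ (hit-forget a t x) (occurrences-removeValue a ts x)

  defined-removeValue : ∀ {n k} (a : Fin (suc n)) (t : PartialMap (suc n) k) →
                        defined (removeValue a t) + occurrences a t ≡ defined t
  defined-removeValue a []              = refl
  defined-removeValue a (nothing ∷ ts)  = defined-removeValue a ts
  defined-removeValue a (just b ∷ ts) with a Fin.≟ b
  ... | yes refl = trans (cong (defined (removeValue a ts) +_) (cong (_+ occurrences a ts) (𝟙-yes (a Fin.≟ a) refl)))
                         (trans (ℕₚ.+-suc _ _) (cong suc (defined-removeValue a ts)))
  ... | no  a≢b  = cong suc (trans (cong (defined (removeValue a ts) +_)
                                          (cong (_+ occurrences a ts) (𝟙-no (b Fin.≟ a) (a≢b ∘ sym))))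
                                   (defined-removeValue a ts))

  defined-removeValue-∉ : ∀ {n k} (a : Fin (suc n)) (ts : PartialMap (suc n) k) →
                          occurrences a ts ≡ 0 → defined (removeValue a ts) ≡ defined ts
  defined-removeValue-∉ a ts a∉ts =
    trans (sym (ℕₚ.+-identityʳ _)) (trans (cong (defined (removeValue a ts) +_) (sym a∉ts)) (defined-removeValue a ts))

  Distinct-removeValue : ∀ {n k} (a : Fin (suc n)) (t : PartialMap (suc n) k) → Distinct t → Distinct (removeValue a t)
  Distinct-removeValue a []             _         = tt
  Distinct-removeValue a (nothing ∷ ts) d         = Distinct-removeValue a ts d
  Distinct-removeValue a (just b ∷ ts)  (o , d) with a Fin.≟ b
  ... | yes _   = Distinct-removeValue a ts d
  ... | no  a≢b = trans (occurrences-removeValue a ts (punchOut a≢b))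
                        (trans (cong (λ c → occurrences c ts) (Finₚ.punchIn-punchOut a≢b)) o)
                , Distinct-removeValue a ts d

  occurrences≤1 : ∀ {n k} (t : PartialMap n k) → Distinct t → ∀ a → occurrences a t ≤ 1
  occurrences≤1 []             _       a = z≤n
  occurrences≤1 (nothing ∷ ts) d       a = occurrences≤1 ts d a
  occurrences≤1 (just b ∷ ts)  (o , d) a with b Fin.≟ a
  ... | yes refl = ℕₚ.≤-reflexive (cong suc o)
  ... | no  _    = occurrences≤1 ts d a

  ∑-occurrences : ∀ {n k} (t : PartialMap n k) → ∑ₗ (allFin n) (λ a → occurrences a t) ≡ defined t
  ∑-occurrences {n} []             = ∑ₗ-zero (allFin n)
  ∑-occurrences {n} (nothing ∷ ts) = ∑-occurrences ts
  ∑-occurrences {n} (just b ∷ ts)  = begin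
    ∑ₗ (allFin n) (λ a → 𝟙 (b Fin.≟ a) + occurrences a ts)
      ≡⟨ ∑ₗ-distrib-+ (allFin n) (λ a → 𝟙 (b Fin.≟ a)) _ ⟩
    ∑ₗ (allFin n) (λ a → 𝟙 (b Fin.≟ a)) + ∑ₗ (allFin n) (λ a → occurrences a ts)
      ≡⟨ cong₂ _+_ (trans (∑ₗ-cong (allFin n) (λ a → sym (ℕₚ.*-identityʳ _))) (∑-allFin-δ n b (λ _ → 1)))
                   (∑-occurrences ts) ⟩
    suc (defined ts) ∎

  defined≤length : ∀ {n k} (t : PartialMap n k) → defined t ≤ k
  defined≤length []             = z≤n
  defined≤length (nothing ∷ ts) = ℕₚ.m≤n⇒m≤1+n (defined≤length ts)
  defined≤length (just _ ∷ ts)  = s≤s (defined≤length ts)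

  injectionMoment : ∀ k n → PartialMap n k → ℕ → ℕ
  injectionMoment k n t m = ∑ₗ (allVecs k n) (λ v → 𝟙inj v * falling (agreements t v) m)

  injectionMoment-cons : ∀ k n t (ts : PartialMap (suc n) k) m →
    injectionMoment (suc k) (suc n) (t ∷ ts) m ≡
    ∑ₗ (allFin (suc n)) (λ a → ∑ₗ (allVecs k n) (λ w → 𝟙inj w * falling (hit t a + agreements (removeValue a ts) w) m))
  injectionMoment-cons k n t ts m = begin
    injectionMoment (suc k) (suc n) (t ∷ ts) m
      ≡⟨ ∑-allVecs-suc k (suc n) _ ⟩
    ∑ₗ (allVecs k (suc n)) (λ v → ∑ₗ (allFin (suc n)) (λ a → 𝟙∉ a v * 𝟙inj v * f a v))
      ≡⟨ ∑ₗ-comm (allVecs k (suc n)) (allFin (suc n)) _ ⟩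
    ∑ₗ (allFin (suc n)) (λ a → ∑ₗ (allVecs k (suc n)) (λ v → 𝟙∉ a v * 𝟙inj v * f a v))
      ≡⟨ ∑ₗ-cong (allFin (suc n)) (λ a → trans (∑ₗ-cong (allVecs k (suc n)) (λ v → ℕₚ.*-assoc (𝟙∉ a v) _ _))
                                                 (∑-avoiding k n a (λ v → 𝟙inj v * f a v))) ⟩
    ∑ₗ (allFin (suc n)) (λ a → ∑ₗ (allVecs k n) (λ w → 𝟙inj (Vec.map (punchIn a) w) * f a (Vec.map (punchIn a) w)))
      ≡⟨ ∑ₗ-cong (allFin (suc n)) (λ a → ∑ₗ-cong (allVecs k n) (λ w →
           cong₂ (λ x y → x * falling (hit t a + y) m) (𝟙inj-punchIn a w) (agreements-punchIn a ts w))) ⟩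
    ∑ₗ (allFin (suc n)) (λ a → ∑ₗ (allVecs k n) (λ w → 𝟙inj w * falling (hit t a + agreements (removeValue a ts) w) m)) ∎
    where
    f : Fin (suc n) → Vec (Fin (suc n)) k → ℕ
    f a v = falling (hit t a + agreements ts v) m

  injectionMoment-suc-agreements : ∀ k n (t : PartialMap n k) m →
    ∑ₗ (allVecs k n) (λ w → 𝟙inj w * falling (suc (agreements t w)) m)
      ≡ injectionMoment k n t m + m * injectionMoment k n t (m ∸ 1)
  injectionMoment-suc-agreements k n t m = begin
    ∑ₗ (allVecs k n) (λ w → 𝟙inj w * falling (suc (agreements t w)) m)
      ≡⟨ ∑ₗ-cong (allVecs k n) (λ w → trans (cong (𝟙inj w *_) (falling-sucˡ (agreements t w) m))
                                            (distrib (𝟙inj w) _ m _)) ⟩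
    ∑ₗ (allVecs k n) (λ w → 𝟙inj w * falling (agreements t w) m + m * (𝟙inj w * falling (agreements t w) (m ∸ 1)))
      ≡⟨ ∑ₗ-distrib-+ (allVecs k n) _ _ ⟩
    injectionMoment k n t m + ∑ₗ (allVecs k n) (λ w → m * (𝟙inj w * falling (agreements t w) (m ∸ 1)))
      ≡⟨ cong (injectionMoment k n t m +_) (*-distribˡ-∑ₗ m (allVecs k n) _) ⟨
    injectionMoment k n t m + m * injectionMoment k n t (m ∸ 1) ∎
    where
    distrib : ∀ i x m y → i * (x + m * y) ≡ i * x + m * (i * y)
    distrib = solve-∀

  injectionMoment-hit : ∀ k n {n′} (c a : Fin n′) (t : PartialMap n k) m →
    ∑ₗ (allVecs k n) (λ w → 𝟙inj w * falling (𝟙 (c Fin.≟ a) + agreements t w) m)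
      ≡ injectionMoment k n t m + 𝟙 (c Fin.≟ a) * (m * injectionMoment k n t (m ∸ 1))
  injectionMoment-hit k n c a t m with c Fin.≟ a
  ... | no  _ = sym (ℕₚ.+-identityʳ _)
  ... | yes _ = trans (injectionMoment-suc-agreements k n t m) (cong (injectionMoment k n t m +_) (sym (ℕₚ.+-identityʳ _)))

  -- Choose the ordered m agreements among the d defined positions, then inject the other
  -- k - m positions into the other n - m values.
  closedForm : ℕ → ℕ → ℕ → ℕ → ℕ
  closedForm k n d m = falling d m * falling (n ∸ m) (k ∸ m)

  closedForm-no-values : ∀ k d m → d ≤ k → closedForm (suc k) zero d m ≡ 0
  closedForm-no-values k d m d≤k with m ℕₚ.≤? k
  ... | yes m≤k rewrite ℕₚ.+-∸-assoc 1 m≤k | ℕₚ.0∸n≡0 m = ℕₚ.*-zeroʳ (falling d m)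
  ... | no  m≰k rewrite falling-<⇒≡0 d m (ℕₚ.≤-<-trans d≤k (ℕₚ.≰⇒> m≰k)) = refl

  closedForm-suc-defined : ∀ k n d m →
    closedForm (suc k) (suc n) d m + m * closedForm k n d (m ∸ 1) ≡ closedForm (suc k) (suc n) (suc d) m
  closedForm-suc-defined k n d zero    = ℕₚ.+-identityʳ _
  closedForm-suc-defined k n d (suc j) = begin
    falling d (suc j) * R + suc j * (falling d j * R) ≡⟨ rearrange (falling d (suc j)) j (falling d j) R ⟩
    (falling d (suc j) + suc j * falling d j) * R      ≡⟨ cong (_* R) (falling-sucˡ d (suc j)) ⟨
    falling (suc d) (suc j) * R                        ∎
    where
    R = falling (n ∸ j) (k ∸ j)
    rearrange : ∀ A j B R → A * R + suc j * (B * R) ≡ (A + suc j * B) * R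
    rearrange = solve-∀

  -- Summing over the n + 1 values, d of which occur in the target:
  -- (n + 1 - d) · closedForm k n d m + d · closedForm k n (d - 1) m = closedForm (k + 1) (n + 1) d m,
  -- stated without subtraction.
  closedForm-remove-one : ∀ k n d m → d ≤ k → d ≤ suc n →
    closedForm (suc k) (suc n) d m + d * closedForm k n d m ≡ d * closedForm k n (d ∸ 1) m + suc n * closedForm k n d m
  closedForm-remove-one k n d m d≤k d≤n with m ℕₚ.≤? d
  ... | no m≰d
    rewrite falling-<⇒≡0 d m (ℕₚ.≰⇒> m≰d)
          | falling-<⇒≡0 (d ∸ 1) m (ℕₚ.≤-<-trans (ℕₚ.m∸n≤m d 1) (ℕₚ.≰⇒> m≰d))
          | ℕₚ.*-zeroʳ d | ℕₚ.*-zeroʳ n = refl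
  ... | yes m≤d = begin
    F * falling b (suc k ∸ m) + d * (F * R)
      ≡⟨ cong (λ x → F * x + d * (F * R)) (falling-suc-∸ n m (ℕₚ.≤-trans m≤d d≤k)) ⟩
    F * (b * R) + d * (F * R)
      ≡⟨ cong (λ x → F * (b * R) + x * (F * R)) (ℕₚ.m∸n+n≡m m≤d) ⟨
    F * (b * R) + (a + m) * (F * R)
      ≡⟨ rearrange F a b m R ⟩
    F * a * R + (b + m) * (F * R)
      ≡⟨ cong₂ (λ x y → x * R + y * (F * R)) (sym (falling-sucʳ d m)) b+m≡1+n ⟩
    d * falling (d ∸ 1) m * R + suc n * (F * R)
      ≡⟨ cong (_+ suc n * (F * R)) (ℕₚ.*-assoc d _ R) ⟩
    d * (falling (d ∸ 1) m * R) + suc n * (F * R) ∎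
    where
    F = falling d m
    R = falling (n ∸ m) (k ∸ m)
    a = d ∸ m
    b = suc n ∸ m
    b+m≡1+n : b + m ≡ suc n
    b+m≡1+n = ℕₚ.m∸n+n≡m (ℕₚ.≤-trans m≤d d≤n)
    rearrange : ∀ F a b m R → F * (b * R) + (a + m) * (F * R) ≡ F * a * R + (b + m) * (F * R)
    rearrange = solve-∀

  interpolate-01 : ∀ o (h : ℕ → ℕ) → o ≤ 1 → h o + o * h 0 ≡ o * h 1 + h 0
  interpolate-01 zero       h _ = ℕₚ.+-identityʳ (h 0)
  interpolate-01 (suc zero) h _ = rearrange (h 1) (h 0)
    where rearrange : ∀ x y → x + (y + 0) ≡ x + 0 + y
          rearrange = solve-∀
  interpolate-01 (suc (suc _)) h (s≤s ())

  ∑-closedForm-removeValue : ∀ k n m (ts : PartialMap (suc n) k) → Distinct ts →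
    ∑ₗ (allFin (suc n)) (λ a → closedForm k n (defined (removeValue a ts)) m) ≡ closedForm (suc k) (suc n) (defined ts) m
  ∑-closedForm-removeValue k n m ts distinct = ℕₚ.+-cancelʳ-≡ _ _ _ (begin
    ∑ₗ (allFin N) (λ a → closedForm k n (defined (removeValue a ts)) m) + d * h 0
      ≡⟨ cong₂ _+_ (∑ₗ-cong (allFin N) (λ a → cong (λ x → closedForm k n x m) (defined-removeValue≡ a)))
                   (cong (_* h 0) (∑-occurrences ts)) ⟨
    ∑ₗ (allFin N) (h ∘ o) + ∑ₗ (allFin N) o * h 0
      ≡⟨ cong (∑ₗ (allFin N) (h ∘ o) +_) (ℕₚ.*-comm (∑ₗ (allFin N) o) (h 0)) ⟩
    ∑ₗ (allFin N) (h ∘ o) + h 0 * ∑ₗ (allFin N) o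
      ≡⟨ cong (∑ₗ (allFin N) (h ∘ o) +_) (trans (*-distribˡ-∑ₗ (h 0) (allFin N) o)
                                                 (∑ₗ-cong (allFin N) (λ a → ℕₚ.*-comm (h 0) (o a)))) ⟩
    ∑ₗ (allFin N) (h ∘ o) + ∑ₗ (allFin N) (λ a → o a * h 0)
      ≡⟨ ∑ₗ-distrib-+ (allFin N) (h ∘ o) _ ⟨
    ∑ₗ (allFin N) (λ a → h (o a) + o a * h 0)
      ≡⟨ ∑ₗ-cong (allFin N) (λ a → interpolate-01 (o a) h (occurrences≤1 ts distinct a)) ⟩
    ∑ₗ (allFin N) (λ a → o a * h 1 + h 0)
      ≡⟨ ∑ₗ-distrib-+ (allFin N) (λ a → o a * h 1) _ ⟩
    ∑ₗ (allFin N) (λ a → o a * h 1) + ∑ₗ (allFin N) (λ _ → h 0)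
      ≡⟨ cong₂ _+_ (trans (∑ₗ-cong (allFin N) (λ a → ℕₚ.*-comm (o a) (h 1)))
                          (trans (sym (*-distribˡ-∑ₗ (h 1) (allFin N) o))
                                 (trans (cong (h 1 *_) (∑-occurrences ts)) (ℕₚ.*-comm (h 1) d))))
                   (∑-allFin-const N (h 0)) ⟩
    d * h 1 + N * h 0
      ≡⟨ closedForm-remove-one k n d m (defined≤length ts) d≤N ⟨
    closedForm (suc k) N d m + d * h 0 ∎)
    where
    N = suc n
    d = defined ts
    o = λ a → occurrences a ts
    h = λ x → closedForm k n (d ∸ x) m
    defined-removeValue≡ : ∀ a → d ∸ o a ≡ defined (removeValue a ts)
    defined-removeValue≡ a = trans (cong (_∸ o a) (sym (defined-removeValue a ts))) (ℕₚ.m+n∸n≡m _ (o a))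
    d≤N : d ≤ N
    d≤N = subst (_≤ N) (∑-occurrences ts) (ℕₚ.≤-trans
            (∑ₗ-mono-≤ (allFin N) (occurrences≤1 ts distinct))
            (ℕₚ.≤-reflexive (trans (∑-allFin-const N 1) (ℕₚ.*-identityʳ N))))

  MomentFormula : ℕ → ℕ → Set
  MomentFormula k n = ∀ (t : PartialMap n k) m → Distinct t → injectionMoment k n t m ≡ closedForm k n (defined t) m

  ∑-injectionMoment-removeValue : ∀ {k n} → MomentFormula k n → ∀ (ts : PartialMap (suc n) k) m → Distinct ts →
    ∑ₗ (allFin (suc n)) (λ a → injectionMoment k n (removeValue a ts) m) ≡ closedForm (suc k) (suc n) (defined ts) m
  ∑-injectionMoment-removeValue {k} {n} formula ts m distinct =
    trans (∑ₗ-cong (allFin (suc n)) (λ a → formula (removeValue a ts) m (Distinct-removeValue a ts distinct)))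
          (∑-closedForm-removeValue k n m ts distinct)

  injectionMoment-just : ∀ {k n} → MomentFormula k n → ∀ c (ts : PartialMap (suc n) k) m →
    occurrences c ts ≡ 0 → Distinct ts →
    injectionMoment (suc k) (suc n) (just c ∷ ts) m ≡ closedForm (suc k) (suc n) (suc (defined ts)) m
  injectionMoment-just {k} {n} formula c ts m c∉ts distinct = begin
    injectionMoment (suc k) (suc n) (just c ∷ ts) m
      ≡⟨ injectionMoment-cons k n (just c) ts m ⟩
    ∑ₗ (allFin (suc n)) (λ a → ∑ₗ (allVecs k n) (λ w → 𝟙inj w * falling (𝟙 (c Fin.≟ a) + agreements (removeValue a ts) w) m))
      ≡⟨ ∑ₗ-cong (allFin (suc n)) (λ a → injectionMoment-hit k n c a (removeValue a ts) m) ⟩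
    ∑ₗ (allFin (suc n)) (λ a → M a m + 𝟙 (c Fin.≟ a) * (m * M a (m ∸ 1)))
      ≡⟨ ∑ₗ-distrib-+ (allFin (suc n)) (λ a → M a m) (λ a → 𝟙 (c Fin.≟ a) * (m * M a (m ∸ 1))) ⟩
    ∑ₗ (allFin (suc n)) (λ a → M a m) + ∑ₗ (allFin (suc n)) (λ a → 𝟙 (c Fin.≟ a) * (m * M a (m ∸ 1)))
      ≡⟨ cong₂ _+_ (∑-injectionMoment-removeValue formula ts m distinct) (∑-allFin-δ (suc n) c (λ a → m * M a (m ∸ 1))) ⟩
    closedForm (suc k) (suc n) d m + m * M c (m ∸ 1)
      ≡⟨ cong (λ x → closedForm (suc k) (suc n) d m + m * x) M-c ⟩
    closedForm (suc k) (suc n) d m + m * closedForm k n d (m ∸ 1)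
      ≡⟨ closedForm-suc-defined k n d m ⟩
    closedForm (suc k) (suc n) (suc d) m ∎
    where
    d = defined ts
    M : Fin (suc n) → ℕ → ℕ
    M a = injectionMoment k n (removeValue a ts)
    M-c : M c (m ∸ 1) ≡ closedForm k n d (m ∸ 1)
    M-c = trans (formula (removeValue c ts) (m ∸ 1) (Distinct-removeValue c ts distinct))
                (cong (λ x → closedForm k n x (m ∸ 1)) (defined-removeValue-∉ c ts c∉ts))

  injectionMoment≡closedForm : ∀ k n → MomentFormula k n
  injectionMoment≡closedForm zero    n       []             m _ rewrite ℕₚ.0∸n≡0 m =
    trans (ℕₚ.+-identityʳ _) (trans (ℕₚ.+-identityʳ _) (sym (ℕₚ.*-identityʳ _)))
  injectionMoment≡closedForm (suc k) zero    (just () ∷ ts) m _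
  injectionMoment≡closedForm (suc k) zero    (nothing ∷ ts) m _ = begin
    injectionMoment (suc k) zero (nothing ∷ ts) m  ≡⟨ ∑-allVecs-suc k zero _ ⟩
    ∑ₗ (allVecs k zero) (λ _ → 0)                  ≡⟨ ∑ₗ-zero (allVecs k zero) ⟩
    0                                              ≡⟨ closedForm-no-values k (defined ts) m (defined≤length ts) ⟨
    closedForm (suc k) zero (defined ts) m         ∎
  injectionMoment≡closedForm (suc k) (suc n) (nothing ∷ ts) m distinct =
    trans (injectionMoment-cons k n nothing ts m)
          (∑-injectionMoment-removeValue (injectionMoment≡closedForm k n) ts m distinct)
  injectionMoment≡closedForm (suc k) (suc n) (just c ∷ ts) m (c∉ts , distinct) =
    injectionMoment-just (injectionMoment≡closedForm k n) c ts m c∉ts distinct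

  agreements-tabulate : ∀ {n k} (g : Fin k → Fin n) (v : Vec (Fin n) k) →
    agreements (Vec.tabulate (just ∘ g)) v ≡ ∑ₗ (allFin k) (λ i → 𝟙 (g i Fin.≟ lookup v i))
  agreements-tabulate g []      = refl
  agreements-tabulate g (a ∷ v) =
    trans (cong (𝟙 (g zero Fin.≟ a) +_) (agreements-tabulate (g ∘ suc) v))
          (sym (∑-allFin-suc _ (λ i → 𝟙 (g i Fin.≟ lookup (a ∷ v) i))))

  occurrences-tabulate : ∀ {n k} (a : Fin n) (g : Fin k → Fin n) → (∀ i → g i ≢ a) →
                         occurrences a (Vec.tabulate (just ∘ g)) ≡ 0
  occurrences-tabulate {k = zero}  a g _   = refl
  occurrences-tabulate {k = suc k} a g g≢a =
    cong₂ _+_ (𝟙-no (g zero Fin.≟ a) (g≢a zero)) (occurrences-tabulate a (g ∘ suc) (g≢a ∘ suc))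

  Distinct-tabulate : ∀ {n k} (g : Fin k → Fin n) → Injective _≡_ _≡_ g → Distinct (Vec.tabulate (just ∘ g))
  Distinct-tabulate {k = zero}  g _   = tt
  Distinct-tabulate {k = suc k} g inj =
    occurrences-tabulate (g zero) (g ∘ suc) (λ i e → Finₚ.0≢1+n (inj (sym e))) ,
    Distinct-tabulate (g ∘ suc) (Finₚ.suc-injective ∘ inj)

  defined-tabulate : ∀ {n k} (g : Fin k → Fin n) → defined (Vec.tabulate (just ∘ g)) ≡ k
  defined-tabulate {k = zero}  g = refl
  defined-tabulate {k = suc k} g = cong suc (defined-tabulate (g ∘ suc))

  fixedPoints≡agreements : ∀ {n} (v : Vec (Fin n) n) → fixedPoints v ≡ agreements (Vec.tabulate just) v
  fixedPoints≡agreements {n} v = begin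
    length (filter (λ i → lookup v i Fin.≟ i) (allFin n))
      ≡⟨ length≡∑ₗ1 (filter (λ i → lookup v i Fin.≟ i) (allFin n)) ⟩
    ∑ₗ (filter (λ i → lookup v i Fin.≟ i) (allFin n)) (λ _ → 1)
      ≡⟨ ∑ₗ-filter (λ i → lookup v i Fin.≟ i) (allFin n) (λ _ → 1) ⟩
    ∑ₗ (allFin n) (λ i → 𝟙 (lookup v i Fin.≟ i) * 1)
      ≡⟨ ∑ₗ-cong (allFin n) (λ i → trans (ℕₚ.*-identityʳ _)
                                         (𝟙-cong sym sym (lookup v i Fin.≟ i) (i Fin.≟ lookup v i))) ⟩
    ∑ₗ (allFin n) (λ i → 𝟙 (i Fin.≟ lookup v i))
      ≡⟨ agreements-tabulate id v ⟨
    agreements (Vec.tabulate just) v ∎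

  ∑-perms-falling-fixedPoints : ∀ n m → m ≤ n → ∑ₗ (perms n) (λ σ → falling (fixedPoints σ) m) ≡ n !
  ∑-perms-falling-fixedPoints n m m≤n = begin
    ∑ₗ (perms n) (λ σ → falling (fixedPoints σ) m)
      ≡⟨ ∑ₗ-filter (λ v → isInjective v Bool.≟ true) (allVecs n n) _ ⟩
    ∑ₗ (allVecs n n) (λ v → 𝟙 (isInjective v Bool.≟ true) * falling (fixedPoints v) m)
      ≡⟨ ∑ₗ-cong (allVecs n n) (λ v → cong₂ (λ x y → x * falling y m)
                                            (𝟙-isInjective v) (fixedPoints≡agreements v)) ⟩
    injectionMoment n n (Vec.tabulate just) m
      ≡⟨ injectionMoment≡closedForm n n (Vec.tabulate just) m (Distinct-tabulate {n} id id) ⟩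
    closedForm n n (defined (Vec.tabulate {n = n} just)) m
      ≡⟨ cong (λ d → closedForm n n d m) (defined-tabulate {n} id) ⟩
    falling n m * falling (n ∸ m) (n ∸ m)
      ≡⟨ falling-split n m m≤n ⟩
    n ! ∎

  ∑-fibres : ∀ {a} {X : Set a} n (h : X → ℕ) (xs : List X) (g : ℕ → ℕ) → (∀ x → h x ≤ n) →
    ∑< (suc n) (λ j → length (filter (λ x → h x ℕ.≟ j) xs) * g j) ≡ ∑ₗ xs (g ∘ h)
  ∑-fibres n h xs g h≤n = begin
    ∑< (suc n) (λ j → length (filter (λ x → h x ℕ.≟ j) xs) * g j)
      ≡⟨ ∑<-cong (suc n) (λ j _ → cong (_* g j) (length-filter j)) ⟩
    ∑< (suc n) (λ j → ∑ₗ xs (λ x → 𝟙 (h x ℕ.≟ j)) * g j)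
      ≡⟨ ∑<-cong (suc n) (λ j _ → trans (ℕₚ.*-comm (∑ₗ xs (λ x → 𝟙 (h x ℕ.≟ j))) (g j))
                                        (*-distribˡ-∑ₗ (g j) xs (λ x → 𝟙 (h x ℕ.≟ j)))) ⟩
    ∑< (suc n) (λ j → ∑ₗ xs (λ x → g j * 𝟙 (h x ℕ.≟ j)))
      ≡⟨ ∑<-∑ₗ-comm (suc n) xs (λ x j → g j * 𝟙 (h x ℕ.≟ j)) ⟩
    ∑ₗ xs (λ x → ∑< (suc n) (λ j → g j * 𝟙 (h x ℕ.≟ j)))
      ≡⟨ ∑ₗ-cong xs (λ x → trans (∑<-cong (suc n) (λ j _ → ℕₚ.*-comm (g j) (𝟙 (h x ℕ.≟ j))))
                                 (∑<-δ (suc n) g (s≤s (h≤n x)))) ⟩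
    ∑ₗ xs (g ∘ h) ∎
    where
    length-filter : ∀ j → length (filter (λ x → h x ℕ.≟ j) xs) ≡ ∑ₗ xs (λ x → 𝟙 (h x ℕ.≟ j))
    length-filter j = begin
      length (filter (λ x → h x ℕ.≟ j) xs)       ≡⟨ length≡∑ₗ1 (filter (λ x → h x ℕ.≟ j) xs) ⟩
      ∑ₗ (filter (λ x → h x ℕ.≟ j) xs) (λ _ → 1) ≡⟨ ∑ₗ-filter (λ x → h x ℕ.≟ j) xs (λ _ → 1) ⟩
      ∑ₗ xs (λ x → 𝟙 (h x ℕ.≟ j) * 1)            ≡⟨ ∑ₗ-cong xs (λ x → ℕₚ.*-identityʳ _) ⟩
      ∑ₗ xs (λ x → 𝟙 (h x ℕ.≟ j))                ∎

  fixedPoints≤ : ∀ {n} (σ : Vec (Fin n) n) → fixedPoints σ ≤ n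
  fixedPoints≤ {n} σ = ℕₚ.≤-trans (Listₚ.length-filter (λ i → lookup σ i Fin.≟ i) (allFin n))
                                  (ℕₚ.≤-reflexive (Listₚ.length-tabulate id))

  ∑-w-falling : ∀ n m → m ≤ n → ∑< (suc n) (λ j → w n j * falling j m) ≡ n !
  ∑-w-falling n m m≤n = trans (∑-fibres n fixedPoints (perms n) (λ j → falling j m) fixedPoints≤)
                              (∑-perms-falling-fixedPoints n m m≤n)

open import Data.Integer as ℤ using (ℤ; +_)
import Data.Integer.Properties as ℤₚ

module ℤ∑ = FiniteSums ℤₚ.+-*-commutativeSemiring

module CharlierPolynomials where

  open import Data.Integer using (_+_; _*_; _-_; -_)
  open import Data.Integer.Tactic.RingSolver using (solve-∀)
  import Data.Nat.Tactic.RingSolver as ℕ-Solver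
  open ℤ∑
  open ≡-Reasoning

  sumℤ-applyUpTo : ∀ (f : ℕ → ℤ) g N → sumℤ (map f (applyUpTo g N)) ≡ ∑< N (f ∘ g)
  sumℤ-applyUpTo f g zero    = refl
  sumℤ-applyUpTo f g (suc N) = cong (_+_ (f (g 0))) (sumℤ-applyUpTo f (g ∘ suc) N)

  ∑<-neg : ∀ N (f : ℕ → ℤ) → ∑< N (λ i → - f i) ≡ - ∑< N f
  ∑<-neg zero    f = refl
  ∑<-neg (suc N) f = trans (cong (_+_ (- f 0)) (∑<-neg N (f ∘ suc))) (sym (ℤₚ.neg-distrib-+ (f 0) _))

  ∑<-distrib-- : ∀ N (f g : ℕ → ℤ) → ∑< N (λ i → f i - g i) ≡ ∑< N f - ∑< N g
  ∑<-distrib-- N f g = trans (∑<-distrib-+ N f (λ i → - g i)) (cong (_+_ (∑< N f)) (∑<-neg N g))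

  charlierCoeff : ℕ → ℕ → ℤ
  charlierCoeff k i = sgn (k ∸ i) * + (k C i)

  Charlier-unfold : ∀ k x → Charlier k x ≡ sgn k + ∑< k (λ i → charlierCoeff k (suc i) * fall x (suc i))
  Charlier-unfold k x = cong (_+_ (sgn k)) (sumℤ-applyUpTo _ id k)

  Charlier-expansion : ∀ k x → Charlier k x ≡ ∑< (suc k) (λ i → charlierCoeff k i * fall x i)
  Charlier-expansion k x = trans (Charlier-unfold k x) (cong₂ _+_ (unit (sgn k)) refl)
    where unit : ∀ s → s ≡ s * + 1 * + 1
          unit = solve-∀

  fall-suc : ∀ x i → fall x (suc i) ≡ x * fall (x - + 1) i
  fall-suc x zero    = lemma x
    where lemma : ∀ x → + 1 * (x - + 0) ≡ x * + 1
          lemma = solve-∀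
  fall-suc x (suc i) = trans (cong (_* (x - + suc i)) (fall-suc x i)) (lemma x (fall (x - + 1) i) (+ i))
    where lemma : ∀ x F a → x * F * (x - (+ 1 + a)) ≡ x * (F * (x - + 1 - a))
          lemma = solve-∀

  fall-Δ : ∀ x i → fall x (suc i) - fall (x - + 1) (suc i) ≡ + suc i * fall (x - + 1) i
  fall-Δ x i = trans (cong (_- fall (x - + 1) (suc i)) (fall-suc x i)) (lemma x (fall (x - + 1) i) (+ i))
    where lemma : ∀ x F a → x * F - F * (x - + 1 - a) ≡ (+ 1 + a) * F
          lemma = solve-∀

  charlierCoeff-top : ∀ k → charlierCoeff k (suc k) ≡ + 0
  charlierCoeff-top k rewrite k>n⇒nCk≡0 {k} {suc k} (ℕₚ.n<1+n k) = ℤₚ.*-zeroʳ (sgn (k ∸ suc k))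

  charlierCoeff-sign-flip : ∀ k i → sgn (k ∸ i) * + (k C suc i) ≡ - charlierCoeff k (suc i)
  charlierCoeff-sign-flip k i with i ℕₚ.<? k
  ... | yes i<k = trans (cong (_* + (k C suc i)) (cong sgn (ℕₚ.+-∸-assoc 1 i<k)))
                        (sym (ℤₚ.neg-distribˡ-* (sgn (k ∸ suc i)) _))
  ... | no  i≮k rewrite k>n⇒nCk≡0 {k} {suc i} (s≤s (ℕₚ.≮⇒≥ i≮k)) =
    trans (ℤₚ.*-zeroʳ (sgn (k ∸ i))) (cong -_ (sym (ℤₚ.*-zeroʳ (sgn (k ∸ suc i)))))

  charlierCoeff-pascal : ∀ k i → charlierCoeff (suc k) (suc i) ≡ charlierCoeff k i - charlierCoeff k (suc i)
  charlierCoeff-pascal k i = begin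
    sgn (k ∸ i) * + (suc k C suc i)
      ≡⟨ cong (λ c → sgn (k ∸ i) * + c) (nCk+nC[k+1]≡[n+1]C[k+1] k i) ⟨
    sgn (k ∸ i) * (+ (k C i) + + (k C suc i))
      ≡⟨ ℤₚ.*-distribˡ-+ (sgn (k ∸ i)) (+ (k C i)) _ ⟩
    charlierCoeff k i + sgn (k ∸ i) * + (k C suc i)
      ≡⟨ cong (_+_ (charlierCoeff k i)) (charlierCoeff-sign-flip k i) ⟩
    charlierCoeff k i - charlierCoeff k (suc i) ∎

  binomial-absorption : ∀ n j → suc j ℕ.* (suc n C suc j) ≡ suc n ℕ.* (n C j)
  binomial-absorption zero    zero    = refl
  binomial-absorption zero    (suc j) = ℕₚ.*-zeroʳ (suc (suc j))
  binomial-absorption (suc n) zero    = trans (ℕₚ.+-identityʳ _) (trans (nC1≡n (suc (suc n))) (sym (ℕₚ.*-identityʳ _)))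
  binomial-absorption (suc n) (suc j) = begin
    suc (suc j) ℕ.* (suc (suc n) C suc (suc j))
      ≡⟨ cong (suc (suc j) ℕ.*_) (nCk+nC[k+1]≡[n+1]C[k+1] (suc n) (suc j)) ⟨
    suc (suc j) ℕ.* (A ℕ.+ B)
      ≡⟨ rearrange j A B ⟩
    A ℕ.+ suc j ℕ.* A ℕ.+ suc (suc j) ℕ.* B
      ≡⟨ cong₂ (λ x y → A ℕ.+ x ℕ.+ y) (binomial-absorption n j) (binomial-absorption n (suc j)) ⟩
    A ℕ.+ suc n ℕ.* (n C j) ℕ.+ suc n ℕ.* (n C suc j)
      ≡⟨ ℕₚ.+-assoc A _ _ ⟩
    A ℕ.+ (suc n ℕ.* (n C j) ℕ.+ suc n ℕ.* (n C suc j))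
      ≡⟨ cong (A ℕ.+_) (ℕₚ.*-distribˡ-+ (suc n) (n C j) _) ⟨
    A ℕ.+ suc n ℕ.* (n C j ℕ.+ n C suc j)
      ≡⟨ cong (λ x → A ℕ.+ suc n ℕ.* x) (nCk+nC[k+1]≡[n+1]C[k+1] n j) ⟩
    suc (suc n) ℕ.* A ∎
    where
    A = suc n C suc j
    B = suc n C suc (suc j)
    rearrange : ∀ j A B → (2 ℕ.+ j) ℕ.* (A ℕ.+ B) ≡ A ℕ.+ (1 ℕ.+ j) ℕ.* A ℕ.+ (2 ℕ.+ j) ℕ.* B
    rearrange = ℕ-Solver.solve-∀

  charlierCoeff-absorption : ∀ k i → charlierCoeff (suc k) (suc i) * + suc i ≡ + suc k * charlierCoeff k i
  charlierCoeff-absorption k i = begin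
    sgn (k ∸ i) * + (suc k C suc i) * + suc i    ≡⟨ rearrange (sgn (k ∸ i)) (+ (suc k C suc i)) (+ suc i) ⟩
    sgn (k ∸ i) * (+ suc i * + (suc k C suc i))  ≡⟨ cong (_*_ (sgn (k ∸ i))) (ℤₚ.pos-* (suc i) _) ⟨
    sgn (k ∸ i) * + (suc i ℕ.* (suc k C suc i))  ≡⟨ cong (λ c → sgn (k ∸ i) * + c) (binomial-absorption k i) ⟩
    sgn (k ∸ i) * + (suc k ℕ.* (k C i))          ≡⟨ cong (_*_ (sgn (k ∸ i))) (ℤₚ.pos-* (suc k) (k C i)) ⟩
    sgn (k ∸ i) * (+ suc k * + (k C i))          ≡⟨ swap (sgn (k ∸ i)) (+ suc k) (+ (k C i)) ⟩
    + suc k * charlierCoeff k i                  ∎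
    where
    rearrange : ∀ s a b → s * a * b ≡ s * (b * a)
    rearrange = solve-∀
    swap : ∀ a b c → a * (b * c) ≡ b * (a * c)
    swap = solve-∀

  Charlier-suc : ∀ k x → Charlier (suc k) x ≡ x * Charlier k (x - + 1) - Charlier k x
  Charlier-suc k x = begin
    Charlier (suc k) x
      ≡⟨ Charlier-unfold (suc k) x ⟩
    - sgn k + ∑< (suc k) (λ i → charlierCoeff (suc k) (suc i) * fall x (suc i))
      ≡⟨ cong (_+_ (- sgn k)) (∑<-cong (suc k) (λ i _ → trans (cong (_* fall x (suc i)) (charlierCoeff-pascal k i))
                                                               (distribʳ (charlierCoeff k i) _ (fall x (suc i))))) ⟩
    - sgn k + ∑< (suc k) (λ i → charlierCoeff k i * fall x (suc i) - charlierCoeff k (suc i) * fall x (suc i))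
      ≡⟨ cong (_+_ (- sgn k)) (∑<-distrib-- (suc k) (λ i → charlierCoeff k i * fall x (suc i)) tail) ⟩
    - sgn k + (∑< (suc k) (λ i → charlierCoeff k i * fall x (suc i)) - ∑< (suc k) tail)
      ≡⟨ cong₂ (λ a b → - sgn k + (a - b)) shifted (∑<-init-last k tail) ⟩
    - sgn k + (x * Charlier k (x - + 1) - (∑< k tail + tail k))
      ≡⟨ cong (λ t → - sgn k + (x * Charlier k (x - + 1) - (∑< k tail + t * fall x (suc k)))) (charlierCoeff-top k) ⟩
    - sgn k + (x * Charlier k (x - + 1) - (∑< k tail + + 0 * fall x (suc k)))
      ≡⟨ rearrange (sgn k) (x * Charlier k (x - + 1)) (∑< k tail) (fall x (suc k)) ⟩
    x * Charlier k (x - + 1) - (sgn k + ∑< k tail)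
      ≡⟨ cong (_-_ (x * Charlier k (x - + 1))) (Charlier-unfold k x) ⟨
    x * Charlier k (x - + 1) - Charlier k x ∎
    where
    tail : ℕ → ℤ
    tail i = charlierCoeff k (suc i) * fall x (suc i)
    shifted : ∑< (suc k) (λ i → charlierCoeff k i * fall x (suc i)) ≡ x * Charlier k (x - + 1)
    shifted = begin
      ∑< (suc k) (λ i → charlierCoeff k i * fall x (suc i))
        ≡⟨ ∑<-cong (suc k) (λ i _ → trans (cong (_*_ (charlierCoeff k i)) (fall-suc x i)) (swap (charlierCoeff k i) x _)) ⟩
      ∑< (suc k) (λ i → x * (charlierCoeff k i * fall (x - + 1) i))
        ≡⟨ *-distribˡ-∑< x (suc k) (λ i → charlierCoeff k i * fall (x - + 1) i) ⟨
      x * ∑< (suc k) (λ i → charlierCoeff k i * fall (x - + 1) i)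
        ≡⟨ cong (_*_ x) (Charlier-expansion k (x - + 1)) ⟨
      x * Charlier k (x - + 1) ∎
      where swap : ∀ a b c → a * (b * c) ≡ b * (a * c)
            swap = solve-∀
    distribʳ : ∀ a b c → (a - b) * c ≡ a * c - b * c
    distribʳ = solve-∀
    rearrange : ∀ s X T F → - s + (X - (T + + 0 * F)) ≡ X - (s + T)
    rearrange = solve-∀

  Charlier-one : ∀ x → Charlier 1 x ≡ x - + 1
  Charlier-one x = trans (Charlier-suc 0 x) (cong (_- + 1) (ℤₚ.*-identityʳ x))

  Charlier-Δ : ∀ k x → Charlier (suc k) x - Charlier (suc k) (x - + 1) ≡ + suc k * Charlier k (x - + 1)
  Charlier-Δ k x = begin
    Charlier (suc k) x - Charlier (suc k) (x - + 1)
      ≡⟨ cong₂ _-_ (Charlier-unfold (suc k) x) (Charlier-unfold (suc k) (x - + 1)) ⟩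
    (- sgn k + ∑< (suc k) (tail x)) - (- sgn k + ∑< (suc k) (tail (x - + 1)))
      ≡⟨ cancel (- sgn k) _ _ ⟩
    ∑< (suc k) (tail x) - ∑< (suc k) (tail (x - + 1))
      ≡⟨ ∑<-distrib-- (suc k) (tail x) (tail (x - + 1)) ⟨
    ∑< (suc k) (λ i → tail x i - tail (x - + 1) i)
      ≡⟨ ∑<-cong (suc k) (λ i _ → difference i) ⟩
    ∑< (suc k) (λ i → + suc k * (charlierCoeff k i * fall (x - + 1) i))
      ≡⟨ *-distribˡ-∑< (+ suc k) (suc k) (λ i → charlierCoeff k i * fall (x - + 1) i) ⟨
    + suc k * ∑< (suc k) (λ i → charlierCoeff k i * fall (x - + 1) i)
      ≡⟨ cong (_*_ (+ suc k)) (Charlier-expansion k (x - + 1)) ⟨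
    + suc k * Charlier k (x - + 1) ∎
    where
    tail : ℤ → ℕ → ℤ
    tail y i = charlierCoeff (suc k) (suc i) * fall y (suc i)
    cancel : ∀ s a b → (s + a) - (s + b) ≡ a - b
    cancel = solve-∀
    difference : ∀ i → tail x i - tail (x - + 1) i ≡ + suc k * (charlierCoeff k i * fall (x - + 1) i)
    difference i = begin
      c * fall x (suc i) - c * fall (x - + 1) (suc i) ≡⟨ factor c _ _ ⟩
      c * (fall x (suc i) - fall (x - + 1) (suc i))   ≡⟨ cong (_*_ c) (fall-Δ x i) ⟩
      c * (+ suc i * fall (x - + 1) i)                ≡⟨ ℤₚ.*-assoc c (+ suc i) _ ⟨
      c * + suc i * fall (x - + 1) i                  ≡⟨ cong (_* fall (x - + 1) i) (charlierCoeff-absorption k i) ⟩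
      + suc k * charlierCoeff k i * fall (x - + 1) i  ≡⟨ ℤₚ.*-assoc (+ suc k) (charlierCoeff k i) (fall (x - + 1) i) ⟩
      + suc k * (charlierCoeff k i * fall (x - + 1) i) ∎
      where
      c = charlierCoeff (suc k) (suc i)
      factor : ∀ c a b → c * a - c * b ≡ c * (a - b)
      factor = solve-∀

  Charlier-three-term : ∀ k x →
    Charlier (suc (suc k)) x ≡ (x - + suc (suc k)) * Charlier (suc k) x - + suc k * Charlier k x
  Charlier-three-term k x = begin
    Charlier (suc (suc k)) x                            ≡⟨ Charlier-suc (suc k) x ⟩
    x * Charlier (suc k) (x - + 1) - Charlier (suc k) x ≡⟨ cong (λ c → x * c - Charlier (suc k) x) Charlier-shifted ⟩
    x * (Charlier (suc k) x - + suc k * D) - Charlier (suc k) x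
      ≡⟨ cong (λ c → x * (c - + suc k * D) - c) (Charlier-suc k x) ⟩
    x * ((x * D - Charlier k x) - + suc k * D) - (x * D - Charlier k x)
      ≡⟨ rearrange x D (Charlier k x) (+ k) ⟩
    (x - + suc (suc k)) * (x * D - Charlier k x) - + suc k * Charlier k x
      ≡⟨ cong (λ c → (x - + suc (suc k)) * c - + suc k * Charlier k x) (Charlier-suc k x) ⟨
    (x - + suc (suc k)) * Charlier (suc k) x - + suc k * Charlier k x ∎
    where
    D = Charlier k (x - + 1)
    Charlier-shifted : Charlier (suc k) (x - + 1) ≡ Charlier (suc k) x - + suc k * D
    Charlier-shifted = trans (difference-solve (Charlier (suc k) x) _) (cong (_-_ (Charlier (suc k) x)) (Charlier-Δ k x))
      where difference-solve : ∀ a b → b ≡ a - (a - b)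
            difference-solve = solve-∀
    rearrange : ∀ x D C K → x * ((x * D - C) - (+ 1 + K) * D) - (x * D - C) ≡ (x - (+ 2 + K)) * (x * D - C) - (+ 1 + K) * C
    rearrange = solve-∀

module Orthogonality where

  open import Data.Integer using (_+_; _*_; _-_; -_)
  open import Data.Integer.Tactic.RingSolver using (solve-∀)
  open ℤ∑
  open CharlierPolynomials
  open FixedPointMoments using (falling; falling-<⇒≡0; falling-sucʳ; falling-diag; ∑-w-falling)
  open ≡-Reasoning

  fall-+ : ∀ j i → fall (+ j) i ≡ + falling j i
  fall-+ j zero    = refl
  fall-+ j (suc i) with i ℕₚ.≤? j
  ... | yes i≤j = begin
    fall (+ j) i * (+ j - + i)    ≡⟨ cong₂ _*_ (fall-+ j i) (trans (ℤₚ.m-n≡m⊖n j i) (ℤₚ.⊖-≥ i≤j)) ⟩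
    + falling j i * + (j ∸ i)     ≡⟨ ℤₚ.pos-* (falling j i) (j ∸ i) ⟨
    + (falling j i ℕ.* (j ∸ i))   ≡⟨ cong +_ (falling-sucʳ j i) ⟨
    + falling j (suc i)           ∎
  ... | no i≰j rewrite fall-+ j i
                     | falling-<⇒≡0 j i (ℕₚ.≰⇒> i≰j)
                     | falling-<⇒≡0 j (suc i) (ℕₚ.m<n⇒m<1+n (ℕₚ.≰⇒> i≰j)) = refl

  pos-∑< : ∀ N (f : ℕ → ℕ) → + ℕ∑.∑< N f ≡ ∑< N (λ i → + f i)
  pos-∑< zero    f = refl
  pos-∑< (suc N) f = trans (ℤₚ.pos-+ (f 0) _) (cong (_+_ (+ f 0)) (pos-∑< N (f ∘ suc)))

  ∑w : ℕ → (ℕ → ℤ) → ℤ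
  ∑w n g = ∑< (suc n) (λ j → + w n j * g j)

  ∑w-cong : ∀ n {f g : ℕ → ℤ} → (∀ j → j ≤ n → f j ≡ g j) → ∑w n f ≡ ∑w n g
  ∑w-cong n f≗g = ∑<-cong (suc n) (λ j j≤n → cong (_*_ (+ w n j)) (f≗g j (ℕₚ.≤-pred j≤n)))

  ∑w-+ : ∀ n (f g : ℕ → ℤ) → ∑w n (λ j → f j + g j) ≡ ∑w n f + ∑w n g
  ∑w-+ n f g = trans (∑<-cong (suc n) (λ j _ → ℤₚ.*-distribˡ-+ (+ w n j) (f j) (g j)))
                     (∑<-distrib-+ (suc n) (λ j → + w n j * f j) (λ j → + w n j * g j))

  ∑w-* : ∀ n c (f : ℕ → ℤ) → ∑w n (λ j → c * f j) ≡ c * ∑w n f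
  ∑w-* n c f = trans (∑<-cong (suc n) (λ j _ → swap (+ w n j) c (f j))) (sym (*-distribˡ-∑< c (suc n) (λ j → + w n j * f j)))
    where swap : ∀ a b c → a * (b * c) ≡ b * (a * c)
          swap = solve-∀

  ∑w-- : ∀ n (f g : ℕ → ℤ) → ∑w n (λ j → f j - g j) ≡ ∑w n f - ∑w n g
  ∑w-- n f g = begin
    ∑w n (λ j → f j - g j)           ≡⟨ ∑w-+ n f (λ j → - g j) ⟩
    ∑w n f + ∑w n (λ j → - g j)
      ≡⟨ cong (_+_ (∑w n f)) (∑<-cong (suc n) (λ j _ → sym (ℤₚ.neg-distribʳ-* (+ w n j) (g j)))) ⟩
    ∑w n f + ∑< (suc n) (λ j → - (+ w n j * g j))
      ≡⟨ cong (_+_ (∑w n f)) (∑<-neg (suc n) (λ j → + w n j * g j)) ⟩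
    ∑w n f - ∑w n g ∎

  ∑w-∑< : ∀ n N (F : ℕ → ℕ → ℤ) → ∑w n (λ j → ∑< N (λ l → F l j)) ≡ ∑< N (λ l → ∑w n (F l))
  ∑w-∑< n zero    F = ∑<-zero (suc n) (λ j _ → ℤₚ.*-zeroʳ (+ w n j))
  ∑w-∑< n (suc N) F = trans (∑w-+ n (F 0) (λ j → ∑< N (λ l → F (suc l) j)))
                            (cong (_+_ (∑w n (F 0))) (∑w-∑< n N (F ∘ suc)))

  ∑w-fall : ∀ n m → m ≤ n → ∑w n (λ j → fall (+ j) m) ≡ + (n !)
  ∑w-fall n m m≤n = begin
    ∑w n (λ j → fall (+ j) m)                   ≡⟨ ∑w-cong n (λ j _ → fall-+ j m) ⟩
    ∑< (suc n) (λ j → + w n j * + falling j m)  ≡⟨ ∑<-cong (suc n) (λ j _ → ℤₚ.pos-* (w n j) (falling j m)) ⟨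
    ∑< (suc n) (λ j → + (w n j ℕ.* falling j m)) ≡⟨ pos-∑< (suc n) (λ j → w n j ℕ.* falling j m) ⟨
    + ℕ∑.∑< (suc n) (λ j → w n j ℕ.* falling j m) ≡⟨ cong +_ (∑-w-falling n m m≤n) ⟩
    + (n !)                                     ∎

  ∑w-fall-Charlier-step : ∀ n s i →
    ∑w n (λ j → fall (+ j) i * Charlier (suc (suc s)) (+ j))
      ≡ ∑w n (λ j → fall (+ j) (suc i) * Charlier (suc s) (+ j))
        + (+ i - + suc (suc s)) * ∑w n (λ j → fall (+ j) i * Charlier (suc s) (+ j))
        - + suc s * ∑w n (λ j → fall (+ j) i * Charlier s (+ j))
  ∑w-fall-Charlier-step n s i = begin
    ∑w n (λ j → fall (+ j) i * Charlier (suc (suc s)) (+ j))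
      ≡⟨ ∑w-cong n (λ j _ → trans (cong (_*_ (fall (+ j) i)) (Charlier-three-term s (+ j)))
                                  (rearrange (fall (+ j) i) (+ j) (+ i) (+ suc (suc s)) (+ suc s) _ _)) ⟩
    ∑w n (λ j → A j + B j - C j)       ≡⟨ ∑w-- n (λ j → A j + B j) C ⟩
    ∑w n (λ j → A j + B j) - ∑w n C    ≡⟨ cong (_- ∑w n C) (∑w-+ n A B) ⟩
    ∑w n A + ∑w n B - ∑w n C
      ≡⟨ cong₂ (λ b c → ∑w n A + b - c) (∑w-* n (+ i - + suc (suc s)) (λ j → fall (+ j) i * Charlier (suc s) (+ j)))
                                        (∑w-* n (+ suc s) (λ j → fall (+ j) i * Charlier s (+ j))) ⟩
    ∑w n A + (+ i - + suc (suc s)) * ∑w n (λ j → fall (+ j) i * Charlier (suc s) (+ j))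
      - + suc s * ∑w n (λ j → fall (+ j) i * Charlier s (+ j)) ∎
    where
    A B C : ℕ → ℤ
    A j = fall (+ j) (suc i) * Charlier (suc s) (+ j)
    B j = (+ i - + suc (suc s)) * (fall (+ j) i * Charlier (suc s) (+ j))
    C j = + suc s * (fall (+ j) i * Charlier s (+ j))
    rearrange : ∀ F x I S₂ S₁ C₁ C₀ →
      F * ((x - S₂) * C₁ - S₁ * C₀) ≡ F * (x - I) * C₁ + (I - S₂) * (F * C₁) - S₁ * (F * C₀)
    rearrange = solve-∀

  ∑w-fall-Charlier : ∀ n s i → i ℕ.+ s ≤ n → ∑w n (λ j → fall (+ j) i * Charlier s (+ j)) ≡ + (n !) * fall (+ i) s
  ∑w-fall-Charlier n zero i i≤n = begin
    ∑w n (λ j → fall (+ j) i * + 1) ≡⟨ ∑w-cong n (λ j _ → ℤₚ.*-identityʳ (fall (+ j) i)) ⟩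
    ∑w n (λ j → fall (+ j) i)       ≡⟨ ∑w-fall n i (subst (_≤ n) (ℕₚ.+-identityʳ i) i≤n) ⟩
    + (n !)                         ≡⟨ ℤₚ.*-identityʳ (+ (n !)) ⟨
    + (n !) * + 1                   ∎
  ∑w-fall-Charlier n (suc zero) i i+1≤n = begin
    ∑w n (λ j → fall (+ j) i * Charlier 1 (+ j))
      ≡⟨ ∑w-cong n (λ j _ → trans (cong (_*_ (fall (+ j) i)) (Charlier-one (+ j))) (split (fall (+ j) i) (+ j) (+ i))) ⟩
    ∑w n (λ j → fall (+ j) (suc i) + (+ i - + 1) * fall (+ j) i)
      ≡⟨ ∑w-+ n (λ j → fall (+ j) (suc i)) (λ j → (+ i - + 1) * fall (+ j) i) ⟩
    ∑w n (λ j → fall (+ j) (suc i)) + ∑w n (λ j → (+ i - + 1) * fall (+ j) i)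
      ≡⟨ cong (_+_ (∑w n (λ j → fall (+ j) (suc i)))) (∑w-* n (+ i - + 1) (λ j → fall (+ j) i)) ⟩
    ∑w n (λ j → fall (+ j) (suc i)) + (+ i - + 1) * ∑w n (λ j → fall (+ j) i)
      ≡⟨ cong₂ (λ a b → a + (+ i - + 1) * b) (∑w-fall n (suc i) (subst (_≤ n) (ℕₚ.+-comm i 1) i+1≤n))
                                             (∑w-fall n i (ℕₚ.≤-trans (ℕₚ.m≤m+n i 1) i+1≤n)) ⟩
    + (n !) + (+ i - + 1) * + (n !)
      ≡⟨ collect (+ (n !)) (+ i) ⟩
    + (n !) * fall (+ i) 1 ∎
    where
    split : ∀ F x I → F * (x - + 1) ≡ F * (x - I) + (I - + 1) * F
    split = solve-∀
    collect : ∀ N I → N + (I - + 1) * N ≡ N * (+ 1 * (I - + 0))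
    collect = solve-∀
  ∑w-fall-Charlier n (suc (suc s)) i i+s+2≤n = begin
    ∑w n (λ j → fall (+ j) i * Charlier (suc (suc s)) (+ j))
      ≡⟨ ∑w-fall-Charlier-step n s i ⟩
    ∑w n (λ j → fall (+ j) (suc i) * Charlier (suc s) (+ j))
      + (+ i - + suc (suc s)) * ∑w n (λ j → fall (+ j) i * Charlier (suc s) (+ j))
      - + suc s * ∑w n (λ j → fall (+ j) i * Charlier s (+ j))
      ≡⟨ cong₂ (λ a b → a + (+ i - + suc (suc s)) * b - + suc s * ∑w n (λ j → fall (+ j) i * Charlier s (+ j)))
               (∑w-fall-Charlier n (suc s) (suc i) (subst (_≤ n) (ℕₚ.+-suc i (suc s)) i+s+2≤n))
               (∑w-fall-Charlier n (suc s) i (ℕₚ.≤-trans (ℕₚ.+-monoʳ-≤ i (ℕₚ.n≤1+n (suc s))) i+s+2≤n)) ⟩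
    N * fall (+ suc i) (suc s) + (+ i - + suc (suc s)) * (N * fall (+ i) (suc s))
      - + suc s * ∑w n (λ j → fall (+ j) i * Charlier s (+ j))
      ≡⟨ cong₂ (λ a b → N * a + (+ i - + suc (suc s)) * (N * fall (+ i) (suc s)) - + suc s * b)
               (trans (fall-suc (+ suc i) s) (cong (λ y → + suc i * fall y s) (ℤₚ.m-n≡m⊖n (suc i) 1)))
               (∑w-fall-Charlier n s i (ℕₚ.≤-trans (ℕₚ.+-monoʳ-≤ i (ℕₚ.m≤n+m s 2)) i+s+2≤n)) ⟩
    N * (+ suc i * fall (+ i) s) + (+ i - + suc (suc s)) * (N * fall (+ i) (suc s)) - + suc s * (N * fall (+ i) s)
      ≡⟨ collect N (fall (+ i) s) (+ i) (+ s) ⟩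
    N * fall (+ i) (suc (suc s)) ∎
    where
    N = + (n !)
    collect : ∀ N F I S → N * ((+ 1 + I) * F) + (I - (+ 2 + S)) * (N * (F * (I - S))) - (+ 1 + S) * (N * F)
                          ≡ N * (F * (I - S) * (I - (+ 1 + S)))
    collect = solve-∀

  fall-<⇒≡0 : ∀ l s → l < s → fall (+ l) s ≡ + 0
  fall-<⇒≡0 l s l<s = trans (fall-+ l s) (cong +_ (falling-<⇒≡0 l s l<s))

  ∑w-Charlier-product : ∀ n r s → r ℕ.+ s ≤ n →
    ∑w n (λ j → Charlier r (+ j) * Charlier s (+ j)) ≡ ∑< (suc r) (λ l → charlierCoeff r l * (+ (n !) * fall (+ l) s))
  ∑w-Charlier-product n r s r+s≤n = begin
    ∑w n (λ j → Charlier r (+ j) * Charlier s (+ j))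
      ≡⟨ ∑w-cong n (λ j _ → expand (+ j)) ⟩
    ∑w n (λ j → ∑< (suc r) (λ l → charlierCoeff r l * (fall (+ j) l * Charlier s (+ j))))
      ≡⟨ ∑w-∑< n (suc r) (λ l j → charlierCoeff r l * (fall (+ j) l * Charlier s (+ j))) ⟩
    ∑< (suc r) (λ l → ∑w n (λ j → charlierCoeff r l * (fall (+ j) l * Charlier s (+ j))))
      ≡⟨ ∑<-cong (suc r) (λ l l≤r → trans (∑w-* n (charlierCoeff r l) (λ j → fall (+ j) l * Charlier s (+ j)))
           (cong (_*_ (charlierCoeff r l))
                 (∑w-fall-Charlier n s l (ℕₚ.≤-trans (ℕₚ.+-monoˡ-≤ s (ℕₚ.≤-pred l≤r)) r+s≤n)))) ⟩
    ∑< (suc r) (λ l → charlierCoeff r l * (+ (n !) * fall (+ l) s)) ∎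
    where
    expand : ∀ x → Charlier r x * Charlier s x ≡ ∑< (suc r) (λ l → charlierCoeff r l * (fall x l * Charlier s x))
    expand x = begin
      Charlier r x * Charlier s x
        ≡⟨ cong (_* Charlier s x) (Charlier-expansion r x) ⟩
      ∑< (suc r) (λ l → charlierCoeff r l * fall x l) * Charlier s x
        ≡⟨ ℤₚ.*-comm _ (Charlier s x) ⟩
      Charlier s x * ∑< (suc r) (λ l → charlierCoeff r l * fall x l)
        ≡⟨ *-distribˡ-∑< (Charlier s x) (suc r) (λ l → charlierCoeff r l * fall x l) ⟩
      ∑< (suc r) (λ l → Charlier s x * (charlierCoeff r l * fall x l))
        ≡⟨ ∑<-cong (suc r) (λ l _ → rotate (Charlier s x) (charlierCoeff r l) (fall x l)) ⟩
      ∑< (suc r) (λ l → charlierCoeff r l * (fall x l * Charlier s x)) ∎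
      where rotate : ∀ a b c → a * (b * c) ≡ b * (c * a)
            rotate = solve-∀

  Charlier-orthogonal-< : ∀ n r s → r < s → r ℕ.+ s ≤ n → ∑w n (λ j → Charlier r (+ j) * Charlier s (+ j)) ≡ + 0
  Charlier-orthogonal-< n r s r<s r+s≤n = trans (∑w-Charlier-product n r s r+s≤n) (∑<-zero (suc r) (λ l l≤r →
    trans (cong (λ y → charlierCoeff r l * (+ (n !) * y)) (fall-<⇒≡0 l s (ℕₚ.≤-<-trans (ℕₚ.≤-pred l≤r) r<s)))
          (annihilate (charlierCoeff r l) (+ (n !)))))
    where annihilate : ∀ a b → a * (b * + 0) ≡ + 0
          annihilate = solve-∀

  Charlier-norm : ∀ n r → r ℕ.+ r ≤ n → ∑w n (λ j → Charlier r (+ j) * Charlier r (+ j)) ≡ + (n ! ℕ.* r !)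
  Charlier-norm n r r+r≤n = begin
    ∑w n (λ j → Charlier r (+ j) * Charlier r (+ j))
      ≡⟨ ∑w-Charlier-product n r r r+r≤n ⟩
    ∑< (suc r) term
      ≡⟨ ∑<-init-last r term ⟩
    ∑< r term + term r
      ≡⟨ cong₂ _+_ (∑<-zero r (λ l l<r → trans (cong (λ y → charlierCoeff r l * (+ (n !) * y)) (fall-<⇒≡0 l r l<r))
                                             (annihilate (charlierCoeff r l) (+ (n !)))))
                   (cong₂ (λ c y → c * (+ (n !) * y)) leading (trans (fall-+ r r) (cong +_ (falling-diag r)))) ⟩
    + 0 + + 1 * (+ (n !) * + (r !))
      ≡⟨ simplify (+ (n !) * + (r !)) ⟩
    + (n !) * + (r !)
      ≡⟨ ℤₚ.pos-* (n !) (r !) ⟨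
    + (n ! ℕ.* r !) ∎
    where
    term : ℕ → ℤ
    term l = charlierCoeff r l * (+ (n !) * fall (+ l) r)
    leading : charlierCoeff r r ≡ + 1
    leading = cong₂ (λ d c → sgn d * + c) (ℕₚ.n∸n≡0 r) (nCn≡1 r)
    annihilate : ∀ a b → a * (b * + 0) ≡ + 0
    annihilate = solve-∀
    simplify : ∀ a → + 0 + + 1 * a ≡ a
    simplify = solve-∀

  δ-refl : ∀ r → δ r r ≡ 1
  δ-refl r with r ℕ.≟ r
  ... | yes _   = refl
  ... | no  r≢r = ⊥-elim (r≢r refl)

  δ-≢ : ∀ {r s} → r ≢ s → δ r s ≡ 0
  δ-≢ {r} {s} r≢s with r ℕ.≟ s
  ... | yes r≡s = ⊥-elim (r≢s r≡s)
  ... | no  _   = refl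

  n!*r!*δ≡0 : ∀ n {r s} → r ≢ s → n ! ℕ.* (r ! ℕ.* δ r s) ≡ 0
  n!*r!*δ≡0 n {r} r≢s =
    trans (cong (λ d → n ! ℕ.* (r ! ℕ.* d)) (δ-≢ r≢s))
          (trans (cong (n ! ℕ.*_) (ℕₚ.*-zeroʳ (r !))) (ℕₚ.*-zeroʳ (n !)))

  Charlier-orthogonal : ∀ n r s → r ℕ.+ s ≤ n →
    ∑w n (λ j → Charlier r (+ j) * Charlier s (+ j)) ≡ + (n ! ℕ.* (r ! ℕ.* δ r s))
  Charlier-orthogonal n r s r+s≤n with ℕₚ.<-cmp r s
  ... | tri< r<s r≢s _ = trans (Charlier-orthogonal-< n r s r<s r+s≤n) (cong +_ (sym (n!*r!*δ≡0 n r≢s)))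
  ... | tri> _ r≢s s<r = begin
    ∑w n (λ j → Charlier r (+ j) * Charlier s (+ j))
      ≡⟨ ∑w-cong n (λ j _ → ℤₚ.*-comm (Charlier r (+ j)) (Charlier s (+ j))) ⟩
    ∑w n (λ j → Charlier s (+ j) * Charlier r (+ j))
      ≡⟨ Charlier-orthogonal-< n s r s<r (subst (_≤ n) (ℕₚ.+-comm r s) r+s≤n) ⟩
    + 0
      ≡⟨ cong +_ (n!*r!*δ≡0 n r≢s) ⟨
    + (n ! ℕ.* (r ! ℕ.* δ r s)) ∎
  ... | tri≈ _ refl _ = trans (Charlier-norm n r r+s≤n)
    (cong (λ d → + (n ! ℕ.* d)) (sym (trans (cong (r ! ℕ.*_) (δ-refl r)) (ℕₚ.*-identityʳ (r !)))))

open CharlierPolynomials using (sumℤ-applyUpTo)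
open Orthogonality using (∑w; Charlier-orthogonal)

lemma1 : (n : ℕ) → 1 ≤ n → (r s : ℕ) → 2 ℕ.* r ≤ n → 2 ℕ.* s ≤ n →
    sumTo n (λ k → + w n (n ∸ k) ℤ.* CharlierHat n r (+ k) ℤ.* CharlierHat n s (+ k))
      ≡ + (n ! ℕ.* (r ! ℕ.* δ r s))
lemma1 n _ r s 2r≤n 2s≤n = begin
  sumTo n summand
    ≡⟨ sumℤ-applyUpTo summand id (suc n) ⟩
  ℤ∑.∑< (suc n) summand
    ≡⟨ ℤ∑.∑<-cong (suc n) (λ k k<1+n → reflect k (ℕₚ.≤-pred k<1+n)) ⟩
  ℤ∑.∑< (suc n) (λ k → term (n ∸ k))
    ≡⟨ ℤ∑.∑<-reverse n term ⟩
  ∑w n (λ j → Charlier r (+ j) ℤ.* Charlier s (+ j))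
    ≡⟨ Charlier-orthogonal n r s r+s≤n ⟩
  + (n ! ℕ.* (r ! ℕ.* δ r s)) ∎
  where
  open ≡-Reasoning
  summand term : ℕ → ℤ
  summand k = + w n (n ∸ k) ℤ.* CharlierHat n r (+ k) ℤ.* CharlierHat n s (+ k)
  term j = + w n j ℤ.* (Charlier r (+ j) ℤ.* Charlier s (+ j))
  reflect : ∀ k → k ≤ n → summand k ≡ term (n ∸ k)
  reflect k k≤n rewrite trans (ℤₚ.m-n≡m⊖n n k) (ℤₚ.⊖-≥ k≤n) = ℤₚ.*-assoc (+ w n (n ∸ k)) _ _
  r+s≤n : r ℕ.+ s ≤ n
  r+s≤n = ℕₚ.*-cancelˡ-≤ 2 (subst₂ _≤_ (sym (ℕₚ.*-distribˡ-+ 2 r s)) (cong (n ℕ.+_) (sym (ℕₚ.+-identityʳ n)))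
                                 (ℕₚ.+-mono-≤ 2r≤n 2s≤n))
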